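{- Let $1\le k\le n-1$. The noncommutative symmetric function $\widetilde D_{n,k}=\widetilde X_{P_n}-\widetilde X_{P_{n-k}}\widetilde A_k$ is $\Lambda$-positive, i.e., all its coefficients in the basis $\{\Lambda^I\}$ are nonnegative. As a consequence, the symmetric function $D_{n,k}=X_{P_n}-X_{P_{n-k}}A_k$ is $e$-positive.
   Context: $\mathrm{NSym}=\mathbb{Q}\langle\Lambda_1,\Lambda_2,\dots\rangle$ is the free associative algebra on noncommuting $\Lambda_k$; for a composition $I=(i_1,\dots,i_l)$, $\Lambda^I=\Lambda_{i_1}\cdots\Lambda_{i_l}$, and these form a basis. Define $\widetilde X_{P_m}=\sum_{I=(i_1,\dots,i_l)\vDash m}i_1(i_2-1)\cdots(i_l-1)\Lambda^I$ and $\widetilde A_m=\sum_{I=(i_1,\dots,i_l)\vDash m}(i_1-1)\cdots(i_l-1)\Lambda^I$. $X_{P_m}$ is the chromatic symmetric function of the path on $m$ vertices ($X_G=\sum_c\prod_vx_{c(v)}$ over proper colorings $c\colon V(G)\to\{1,2,\dots\}$). Writing $X_{P_m}=\sum_{\lambda\vdash m}c_\lambda e_\lambda$, let $B_m=\sum_{\lambda:\,1\notin\lambda}c_\lambda e_\lambda$ and define $A_{m-1}$ by $X_{P_m}=e_1A_{m-1}+B_m$. A symmetric function is $e$-positive if all its coefficients in the elementary basis $\{e_\lambda\}$ are nonnegative. -}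

module Defs where

open import Data.Nat as ℕ using (ℕ; zero; suc; _∸_; _≤ᵇ_; _≡ᵇ_)
open import Data.Integer as ℤ using (ℤ; +_; _+_; _*_; _-_)
open import Data.List using (List; []; _∷_; take; drop; length; map; foldr; upTo; concatMap)
open import Data.Nat.ListAction using (sum)
open import Data.Bool.ListAction using (any; all)
open import Data.Bool using (Bool; true; false; if_then_else_; _∧_; not)
open import Data.Product using (Σ; _×_; _,_; proj₁; proj₂)
open import Data.List.Relation.Unary.All using (All)
open import Data.List.Relation.Unary.Linked using (Linked)
open import Relation.Binary.PropositionalEquality using (_≡_)

Σℤ : List ℤ → ℤ
Σℤ = foldr _+_ (+ 0)

Πℤ : List ℤ → ℤ
Πℤ = foldr _*_ (+ 1)

IsComposition : ℕ → List ℕ → Set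
IsComposition m I = All (λ i → 1 ℕ.≤ i) I × sum I ≡ m

isComp : ℕ → List ℕ → Bool
isComp m I = all (λ i → 1 ≤ᵇ i) I ∧ (sum I ≡ᵇ m)

IsPartition : ℕ → List ℕ → Set
IsPartition m λs = Linked (λ a b → b ℕ.≤ a) λs × IsComposition m λs

-- NSym (over ℤ ⊆ ℚ): an element is given by its coefficient function
-- I ↦ (coefficient of Λ^I); only compositions carry nonzero coefficients
-- for the elements defined below.

NSym : Set
NSym = List ℕ → ℤ

-- product: Λ^I Λ^J = Λ^(I ++ J), so the coefficient of Λ^K in F·G is
-- the sum over all splittings K = I ++ J of F(I)·G(J)
_·_ : NSym → NSym → NSym
(F · G) K = Σℤ (map (λ j → F (take j K) * G (drop j K)) (upTo (suc (length K))))

pred1 : ℕ → ℤ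
pred1 i = + i - + 1

weightA : List ℕ → ℤ
weightA I = Πℤ (map pred1 I)

weightX : List ℕ → ℤ
weightX []      = + 1
weightX (i ∷ I) = + i * weightA I

Xt : ℕ → NSym
Xt m I = if isComp m I then weightX I else + 0

At : ℕ → NSym
At m I = if isComp m I then weightA I else + 0

Dt : ℕ → ℕ → NSym
Dt n k I = Xt n I - (Xt (n ∸ k) · At k) I

-- Symmetric functions, evaluated in finitely many variables.
-- A symmetric function F is represented by its specialisations
-- F N x = F(x₀, …, x_{N-1}, 0, 0, …) for all N and all x : ℕ → ℤ.

Vars : Set
Vars = ℕ → ℤ

SymFun : Set
SymFun = ℕ → Vars → ℤ

colourSeqs : ℕ → ℕ → List (List ℕ)
colourSeqs N zero    = [] ∷ []
colourSeqs N (suc m) = concatMap (λ s → map (λ c → c ∷ s) (upTo N)) (colourSeqs N m)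

-- proper colouring of the path P_m (vertices 1..m, edges {i,i+1}):
-- adjacent entries differ
properPath : List ℕ → Bool
properPath (a ∷ b ∷ s) = not (a ≡ᵇ b) ∧ properPath (b ∷ s)
properPath _           = true

XP : ℕ → SymFun
XP m N x = Σℤ (map (λ s → if properPath s then Πℤ (map x s) else + 0) (colourSeqs N m))

eN : ℕ → SymFun
eN zero    N       x = + 1
eN (suc r) zero    x = + 0
eN (suc r) (suc N) x = eN (suc r) N x + x N * eN r N x

eλ : List ℕ → SymFun
eλ λs N x = Πℤ (map (λ r → eN r N x) λs)

ESum : List (List ℕ × ℤ) → SymFun
ESum L N x = Σℤ (map (λ p → proj₂ p * eλ (proj₁ p) N x) L)

IsEExpansion : ℕ → SymFun → List (List ℕ × ℤ) → Set
IsEExpansion m F L =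
  All (λ p → IsPartition m (proj₁ p)) L × ((N : ℕ) (x : Vars) → F N x ≡ ESum L N x)

EPositive : ℕ → SymFun → Set
EPositive m F = Σ (List (List ℕ × ℤ)) λ L → IsEExpansion m F L × All (λ p → + 0 ℤ.≤ proj₂ p) L

has1 : List ℕ → Bool
has1 = any (λ i → i ≡ᵇ 1)

remove1 : List ℕ → List ℕ
remove1 []      = []
remove1 (i ∷ l) = if i ≡ᵇ 1 then l else i ∷ remove1 l

-- Given the e-expansion L of X_{P_m}, A_{m-1} is defined by
-- X_{P_m} = e₁ A_{m-1} + B_m,  B_m = Σ_{1 ∉ λ} c_λ e_λ, i.e.
-- A_{m-1} = Σ_{1 ∈ λ} c_λ e_{λ ∖ {1}}
AFrom : List (List ℕ × ℤ) → SymFun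
AFrom L N x = Σℤ (map (λ p → if has1 (proj₁ p) then proj₂ p * eλ (remove1 (proj₁ p)) N x else + 0) L)

-- (1) In X̃_{P_{n-k}} Ã_k the coefficient of Λ^I comes only from the splitting I = J ++ J′ with
-- J ⊨ n − k, if there is one, and is then i₁(i₂−1)⋯(i_l−1), the coefficient of Λ^I in X̃_{P_n}.
-- (2) Under Λ_i ↦ e_i, X̃_{P_m} maps to X_{P_m}: colouring the first vertex of the path gives
-- X_{P_{m+1}} = Σ_i (−1)^i p_{i+1} X_{P_{m−i}}, and by Newton's identities Σ_I i₁(i₂−1)⋯ e_I obeys the
-- same recurrence. Since the e_λ are linearly independent, e-expansions are unique, so A_k is the image
-- of Ã_k, and D_{n,k} is the image of D̃_{n,k}: the sum of i₁(i₂−1)⋯ e_I over the compositions I of n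
-- with no partial sum equal to n − k.
module Submission where

open import Defs
open import Algebra.Bundles using (CommutativeMonoid)
open import Data.Bool using (true; false; if_then_else_; _∧_; _∨_; T)
open import Data.Bool.ListAction using (all)
open import Data.Bool.Properties using (∨-zeroʳ)
open import Data.Integer as ℤ using (ℤ; +_; -_; _+_; _-_; _*_; ∣_∣)
import Data.Integer.Properties as ℤP
open import Data.Integer.Tactic.RingSolver using (solve-∀)
open import Data.List using (List; []; _∷_; _++_; map; concat; concatMap; applyUpTo; upTo; take; drop; length; replicate; filter)
import Data.List.Properties as LP
open import Data.List.Membership.Propositional using (_∈_)
open import Data.List.Relation.Binary.Permutation.Propositional using (_↭_; ↭-refl; ↭-sym; ↭-trans; ↭-prep; ↭-swap; ↭⇒↭ₛ)
import Data.List.Relation.Binary.Permutation.Propositional.Properties as Perm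
open import Data.List.Relation.Binary.Permutation.Setoid.Properties using (foldr-commMonoid)
open import Data.List.Relation.Unary.All as All using (All; []; _∷_)
import Data.List.Relation.Unary.All.Properties as AllP
open import Data.List.Relation.Unary.Any using (here; there)
open import Data.List.Relation.Unary.Linked as Linked using (Linked; []; [-]; _∷_)
open import Data.Nat as ℕ using (ℕ; zero; suc; _∸_; pred; _≡ᵇ_; _≤ᵇ_; _<ᵇ_; z≤n; s≤s)
open import Data.Nat.Induction using (<-rec)
open import Data.Nat.ListAction using (sum)
open import Data.Nat.ListAction.Properties using (sum-++; sum-↭)
import Data.Nat.Properties as ℕP
open import Data.Product as Product using (∃; ∃₂; _×_; _,_; proj₁; proj₂)
open import Data.Sum using (inj₂)
open import Function using (_∘_)
open import Relation.Binary.Core using (_Preserves_⟶_)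
open import Relation.Binary.Properties.DecTotalOrder ℕP.≤-decTotalOrder using (≥-decTotalOrder)
open import Data.List.Sort.InsertionSort.Base ≥-decTotalOrder using (sort)
open import Data.List.Sort.InsertionSort.Properties ≥-decTotalOrder using (sort-↭; sort-↗)
open import Relation.Binary.PropositionalEquality
open ≡-Reasoning
open import Relation.Nullary using (contradiction; yes; no; ¬?)
open import Relation.Unary using (Decidable)

i+j≡k⇒i≡k-j : ∀ {i j k : ℤ} → i + j ≡ k → i ≡ k - j
i+j≡k⇒i≡k-j {i} {j} refl = ring i j
  where ring : ∀ i j → i ≡ i + j - j
        ring = solve-∀

ΣL : {A : Set} → (A → ℤ) → List A → ℤ
ΣL f l = Σℤ (map f l)

Σℤ-++ : ∀ xs ys → Σℤ (xs ++ ys) ≡ Σℤ xs + Σℤ ys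
Σℤ-++ []       ys = sym (ℤP.+-identityˡ _)
Σℤ-++ (x ∷ xs) ys = trans (cong (_+_ x) (Σℤ-++ xs ys)) (sym (ℤP.+-assoc x _ _))

module _ {A : Set} where

  ΣL-++ : ∀ (f : A → ℤ) xs ys → ΣL f (xs ++ ys) ≡ ΣL f xs + ΣL f ys
  ΣL-++ f xs ys = trans (cong Σℤ (LP.map-++ f xs ys)) (Σℤ-++ (map f xs) (map f ys))

  ΣL-cong : ∀ {f g : A → ℤ} → (∀ a → f a ≡ g a) → ∀ l → ΣL f l ≡ ΣL g l
  ΣL-cong e []      = refl
  ΣL-cong e (a ∷ l) = cong₂ _+_ (e a) (ΣL-cong e l)

  ΣL-cong-All : ∀ {P : A → Set} {f g : A → ℤ} {l} → All P l → (∀ {a} → P a → f a ≡ g a) → ΣL f l ≡ ΣL g l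
  ΣL-cong-All []       e = refl
  ΣL-cong-All (p ∷ ps) e = cong₂ _+_ (e p) (ΣL-cong-All ps e)

  ΣL-*ˡ : ∀ (c : ℤ) (f : A → ℤ) l → ΣL (λ a → c * f a) l ≡ c * ΣL f l
  ΣL-*ˡ c f []      = sym (ℤP.*-zeroʳ c)
  ΣL-*ˡ c f (a ∷ l) = trans (cong (_+_ (c * f a)) (ΣL-*ˡ c f l)) (sym (ℤP.*-distribˡ-+ c (f a) _))

  ΣL-+ : ∀ (f g : A → ℤ) l → ΣL (λ a → f a + g a) l ≡ ΣL f l + ΣL g l
  ΣL-+ f g []      = refl
  ΣL-+ f g (a ∷ l) = trans (cong (_+_ (f a + g a)) (ΣL-+ f g l)) (ring (f a) (g a) (ΣL f l) (ΣL g l))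
    where ring : ∀ a b c d → (a + b) + (c + d) ≡ (a + c) + (b + d)
          ring = solve-∀

  ΣL-neg : ∀ (f : A → ℤ) l → ΣL (λ a → - f a) l ≡ - ΣL f l
  ΣL-neg f []      = refl
  ΣL-neg f (a ∷ l) = trans (cong (_+_ (- f a)) (ΣL-neg f l)) (sym (ℤP.neg-distrib-+ (f a) _))

  ΣL-0 : ∀ l → ΣL {A} (λ _ → + 0) l ≡ + 0
  ΣL-0 []      = refl
  ΣL-0 (a ∷ l) = trans (ℤP.+-identityˡ _) (ΣL-0 l)

  ΣL-vanish : ∀ {P : A → Set} {f : A → ℤ} {l} → All P l → (∀ {a} → P a → f a ≡ + 0) → ΣL f l ≡ + 0
  ΣL-vanish {l = l} ps e = trans (ΣL-cong-All ps e) (ΣL-0 l)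

  ΣL-partition : ∀ {P : A → Set} (P? : Decidable P) (f : A → ℤ) l →
                 ΣL f l ≡ ΣL f (filter P? l) + ΣL f (filter (¬? ∘ P?) l)
  ΣL-partition P? f []      = refl
  ΣL-partition P? f (a ∷ l) with P? a
  ... | yes _ = trans (cong (_+_ (f a)) (ΣL-partition P? f l)) (sym (ℤP.+-assoc (f a) _ _))
  ... | no  _ = trans (cong (_+_ (f a)) (ΣL-partition P? f l))
                      (ring (f a) (ΣL f (filter P? l)) (ΣL f (filter (¬? ∘ P?) l)))
    where ring : ∀ a u v → a + (u + v) ≡ u + (a + v)
          ring = solve-∀

module _ {A B : Set} where

  ΣL-map : ∀ (f : B → ℤ) (g : A → B) l → ΣL f (map g l) ≡ ΣL (f ∘ g) l
  ΣL-map f g l = cong Σℤ (sym (LP.map-∘ l))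

  ΣL-concatMap : ∀ (f : B → ℤ) (F : A → List B) l → ΣL f (concatMap F l) ≡ ΣL (λ a → ΣL f (F a)) l
  ΣL-concatMap f F []      = refl
  ΣL-concatMap f F (a ∷ l) = trans (ΣL-++ f (F a) (concat (map F l))) (cong (_+_ (ΣL f (F a))) (ΣL-concatMap f F l))

sumBelow : (ℕ → ℤ) → ℕ → ℤ
sumBelow f n = Σℤ (applyUpTo f n)

ΣL-upTo : ∀ (f : ℕ → ℤ) n → ΣL f (upTo n) ≡ sumBelow f n
ΣL-upTo f n = cong Σℤ (LP.map-upTo f n)

sumBelow-cong : ∀ {f g : ℕ → ℤ} → (∀ c → f c ≡ g c) → ∀ n → sumBelow f n ≡ sumBelow g n
sumBelow-cong e zero    = refl
sumBelow-cong e (suc n) = cong₂ _+_ (e 0) (sumBelow-cong (e ∘ suc) n)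

sumBelow-suc : ∀ f n → sumBelow f (suc n) ≡ sumBelow f n + f n
sumBelow-suc f n = begin
  Σℤ (applyUpTo f (suc n))               ≡⟨ cong Σℤ (sym (LP.applyUpTo-∷ʳ f n)) ⟩
  Σℤ (applyUpTo f n ++ f n ∷ [])         ≡⟨ Σℤ-++ (applyUpTo f n) (f n ∷ []) ⟩
  sumBelow f n + (f n + + 0)             ≡⟨ cong (_+_ (sumBelow f n)) (ℤP.+-identityʳ (f n)) ⟩
  sumBelow f n + f n                     ∎

sumBelow-omit : ∀ (f : ℕ → ℤ) b n →
  sumBelow (λ c → if c ≡ᵇ b then + 0 else f c) n + (if b <ᵇ n then f b else + 0) ≡ sumBelow f n
sumBelow-omit f b       zero    = refl
sumBelow-omit f zero    (suc n) = ring (f 0) (sumBelow (f ∘ suc) n)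
  where ring : ∀ a b → (+ 0 + b) + a ≡ a + b
        ring = solve-∀
sumBelow-omit f (suc b) (suc n) = trans (ℤP.+-assoc (f 0) _ _) (cong (_+_ (f 0)) (sumBelow-omit (f ∘ suc) b n))

sumBelow-restrict : ∀ (f : ℕ → ℤ) n → sumBelow f n ≡ sumBelow (λ c → if c <ᵇ n then f c else + 0) n
sumBelow-restrict f zero    = refl
sumBelow-restrict f (suc n) = cong (_+_ (f 0)) (sumBelow-restrict (f ∘ suc) n)

-- Formal power series

Seq : Set
Seq = ℕ → ℤ

infixl 7 _⋆_

_⋆_ : Seq → Seq → Seq
(f ⋆ g) zero    = f 0 * g 0
(f ⋆ g) (suc n) = f 0 * g (suc n) + ((f ∘ suc) ⋆ g) n

δ : Seq
δ zero    = + 1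
δ (suc _) = + 0

⋆-cong : ∀ {f f′ g g′} → (∀ i → f i ≡ f′ i) → (∀ i → g i ≡ g′ i) → ∀ n → (f ⋆ g) n ≡ (f′ ⋆ g′) n
⋆-cong ef eg zero    = cong₂ _*_ (ef 0) (eg 0)
⋆-cong ef eg (suc n) = cong₂ _+_ (cong₂ _*_ (ef 0) (eg (suc n))) (⋆-cong (ef ∘ suc) eg n)

⋆-congʳ-≤ : ∀ f {g g′} n → (∀ i → i ℕ.≤ n → g i ≡ g′ i) → (f ⋆ g) n ≡ (f ⋆ g′) n
⋆-congʳ-≤ f zero    e = cong (f 0 *_) (e 0 z≤n)
⋆-congʳ-≤ f (suc n) e = cong₂ _+_ (cong (f 0 *_) (e (suc n) ℕP.≤-refl))
  (⋆-congʳ-≤ (f ∘ suc) n (λ i i≤n → e i (ℕP.m≤n⇒m≤1+n i≤n)))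

⋆-zeroˡ : ∀ f g n → (∀ i → f i ≡ + 0) → (f ⋆ g) n ≡ + 0
⋆-zeroˡ f g zero    e rewrite e 0 = refl
⋆-zeroˡ f g (suc n) e rewrite e 0 = trans (ℤP.+-identityˡ _) (⋆-zeroˡ (f ∘ suc) g n (e ∘ suc))

scaledδ : ℤ → Seq
scaledδ a zero    = a
scaledδ a (suc _) = + 0

⋆-scaledδˡ : ∀ a g n → (scaledδ a ⋆ g) n ≡ a * g n
⋆-scaledδˡ a g zero    = refl
⋆-scaledδˡ a g (suc n) = trans (cong (_+_ (a * g (suc n))) (⋆-zeroˡ _ g n (λ _ → refl))) (ℤP.+-identityʳ _)

⋆-identityˡ : ∀ g n → (δ ⋆ g) n ≡ g n
⋆-identityˡ g n = trans (⋆-cong (λ { zero → refl ; (suc _) → refl }) (λ _ → refl) n)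
                        (trans (⋆-scaledδˡ (+ 1) g n) (ℤP.*-identityˡ (g n)))

⋆-suc : ∀ f g n → (f ⋆ g) (suc n) ≡ (f ⋆ (g ∘ suc)) n + f (suc n) * g 0
⋆-suc f g zero    = refl
⋆-suc f g (suc n) = trans (cong (_+_ (f 0 * g (suc (suc n)))) (⋆-suc (f ∘ suc) g n))
                          (sym (ℤP.+-assoc (f 0 * g (suc (suc n))) _ _))

⋆-comm : ∀ f g n → (f ⋆ g) n ≡ (g ⋆ f) n
⋆-comm f g zero    = ℤP.*-comm (f 0) (g 0)
⋆-comm f g (suc n) = begin
  f 0 * g (suc n) + ((f ∘ suc) ⋆ g) n     ≡⟨ cong (_+_ (f 0 * g (suc n))) (⋆-comm (f ∘ suc) g n) ⟩
  f 0 * g (suc n) + (g ⋆ (f ∘ suc)) n     ≡⟨ ℤP.+-comm (f 0 * g (suc n)) _ ⟩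
  (g ⋆ (f ∘ suc)) n + f 0 * g (suc n)     ≡⟨ cong (_+_ ((g ⋆ (f ∘ suc)) n)) (ℤP.*-comm (f 0) (g (suc n))) ⟩
  (g ⋆ (f ∘ suc)) n + g (suc n) * f 0     ≡⟨ sym (⋆-suc g f n) ⟩
  (g ⋆ f) (suc n)                         ∎

⋆-linearˡ : ∀ (a : ℤ) f h g n → ((λ i → a * f i + h i) ⋆ g) n ≡ a * (f ⋆ g) n + (h ⋆ g) n
⋆-linearˡ a f h g zero    = ring a (f 0) (h 0) (g 0)
  where ring : ∀ a b c d → (a * b + c) * d ≡ a * (b * d) + c * d
        ring = solve-∀
⋆-linearˡ a f h g (suc n) =
  trans (cong (_+_ ((a * f 0 + h 0) * g (suc n))) (⋆-linearˡ a (f ∘ suc) (h ∘ suc) g n))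
        (ring a (f 0) (h 0) (g (suc n)) (((f ∘ suc) ⋆ g) n) (((h ∘ suc) ⋆ g) n))
  where ring : ∀ a b c d u v → (a * b + c) * d + (a * u + v) ≡ a * (b * d + u) + (c * d + v)
        ring = solve-∀

⋆-distribʳ-+ : ∀ f h g n → ((λ i → f i + h i) ⋆ g) n ≡ (f ⋆ g) n + (h ⋆ g) n
⋆-distribʳ-+ f h g zero    = ℤP.*-distribʳ-+ (g 0) (f 0) (h 0)
⋆-distribʳ-+ f h g (suc n) =
  trans (cong (_+_ ((f 0 + h 0) * g (suc n))) (⋆-distribʳ-+ (f ∘ suc) (h ∘ suc) g n))
        (ring (f 0) (h 0) (g (suc n)) (((f ∘ suc) ⋆ g) n) (((h ∘ suc) ⋆ g) n))
  where ring : ∀ a b c d e → (a + b) * c + (d + e) ≡ (a * c + d) + (b * c + e)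
        ring = solve-∀

⋆-distribˡ-+ : ∀ f g h n → (f ⋆ (λ i → g i + h i)) n ≡ (f ⋆ g) n + (f ⋆ h) n
⋆-distribˡ-+ f g h n = trans (⋆-comm f _ n) (trans (⋆-distribʳ-+ g h f n) (cong₂ _+_ (⋆-comm g f n) (⋆-comm h f n)))

⋆-negˡ : ∀ f g n → ((λ i → - f i) ⋆ g) n ≡ - (f ⋆ g) n
⋆-negˡ f g zero    = sym (ℤP.neg-distribˡ-* (f 0) (g 0))
⋆-negˡ f g (suc n) =
  trans (cong₂ _+_ (sym (ℤP.neg-distribˡ-* (f 0) (g (suc n)))) (⋆-negˡ (f ∘ suc) g n))
        (sym (ℤP.neg-distrib-+ (f 0 * g (suc n)) _))

⋆-distribʳ-- : ∀ f h g n → ((λ i → f i - h i) ⋆ g) n ≡ (f ⋆ g) n - (h ⋆ g) n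
⋆-distribʳ-- f h g zero    = ring (f 0) (h 0) (g 0)
  where ring : ∀ a b c → (a - b) * c ≡ a * c - b * c
        ring = solve-∀
⋆-distribʳ-- f h g (suc n) =
  trans (cong (_+_ ((f 0 - h 0) * g (suc n))) (⋆-distribʳ-- (f ∘ suc) (h ∘ suc) g n))
        (ring (f 0) (h 0) (g (suc n)) (((f ∘ suc) ⋆ g) n) (((h ∘ suc) ⋆ g) n))
  where ring : ∀ a b c d e → (a - b) * c + (d - e) ≡ (a * c + d) - (b * c + e)
        ring = solve-∀

⋆-assoc : ∀ f g h n → ((f ⋆ g) ⋆ h) n ≡ (f ⋆ (g ⋆ h)) n
⋆-assoc f g h zero    = ℤP.*-assoc (f 0) (g 0) (h 0)
⋆-assoc f g h (suc n) = begin
  (f ⋆ g) 0 * h (suc n) + (((f ⋆ g) ∘ suc) ⋆ h) n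
    ≡⟨ cong (_+_ ((f ⋆ g) 0 * h (suc n))) (⋆-linearˡ (f 0) (g ∘ suc) ((f ∘ suc) ⋆ g) h n) ⟩
  (f ⋆ g) 0 * h (suc n) + (f 0 * ((g ∘ suc) ⋆ h) n + (((f ∘ suc) ⋆ g) ⋆ h) n)
    ≡⟨ cong (λ z → (f ⋆ g) 0 * h (suc n) + (f 0 * ((g ∘ suc) ⋆ h) n + z)) (⋆-assoc (f ∘ suc) g h n) ⟩
  f 0 * g 0 * h (suc n) + (f 0 * ((g ∘ suc) ⋆ h) n + ((f ∘ suc) ⋆ (g ⋆ h)) n)
    ≡⟨ ring (f 0) (g 0) (h (suc n)) (((g ∘ suc) ⋆ h) n) (((f ∘ suc) ⋆ (g ⋆ h)) n) ⟩
  f 0 * (g 0 * h (suc n) + ((g ∘ suc) ⋆ h) n) + ((f ∘ suc) ⋆ (g ⋆ h)) n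
    ∎
  where ring : ∀ a b c d e → a * b * c + (a * d + e) ≡ a * (b * c + d) + e
        ring = solve-∀

⋆-recurrence-unique : ∀ (f S T : Seq) → S 0 ≡ T 0 →
  (∀ m → S (suc m) ≡ (f ⋆ S) m) → (∀ m → T (suc m) ≡ (f ⋆ T) m) → ∀ n → S n ≡ T n
⋆-recurrence-unique f S T e₀ eS eT n = below n n ℕP.≤-refl
  where
    below : ∀ n i → i ℕ.≤ n → S i ≡ T i
    below n       zero    _         = e₀
    below (suc n) (suc i) (s≤s i≤n) =
      trans (eS i) (trans (⋆-congʳ-≤ f i (λ j j≤i → below n j (ℕP.≤-trans j≤i i≤n))) (sym (eT i)))

sgn : ℕ → ℤ
sgn zero    = + 1
sgn (suc i) = - sgn i

powerSum : ℕ → Vars → ℕ → ℤ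
powerSum N x j = sumBelow (λ c → x c ℤ.^ j) N

signedPowerSums : ℕ → Vars → ℕ → Seq
signedPowerSums N x j i = sgn i * powerSum N x (suc (j ℕ.+ i))

module PathColourings (N : ℕ) (x : Vars) where

  p : ℕ → ℤ
  p = powerSum N x

  S : Seq
  S m = XP m N x

  weight : List ℕ → ℤ
  weight s = if properPath s then Πℤ (map x s) else + 0

  headPower : ℕ → List ℕ → ℤ
  headPower j []      = + 0
  headPower j (b ∷ _) = if b <ᵇ N then x b ℤ.^ j else + 0

  U : ℕ → Seq
  U j m = ΣL (λ s → weight s * headPower j s) (colourSeqs N m)

  compatible : ℕ → List ℕ → ℤ
  compatible c []      = x c
  compatible c (b ∷ _) = if c ≡ᵇ b then + 0 else x c

  weight-∷ : ∀ c s → weight (c ∷ s) ≡ compatible c s * weight s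
  weight-∷ c []      = refl
  weight-∷ c (b ∷ s) with c ≡ᵇ b
  ... | true  = refl
  ... | false with properPath (b ∷ s)
  ...   | true  = refl
  ...   | false = sym (ℤP.*-zeroʳ (x c))

  ΣL-colourSeqs-suc : ∀ (F : List ℕ → ℤ) m →
    ΣL F (colourSeqs N (suc m)) ≡ ΣL (λ s → ΣL (λ c → F (c ∷ s)) (upTo N)) (colourSeqs N m)
  ΣL-colourSeqs-suc F m =
    trans (ΣL-concatMap F _ (colourSeqs N m)) (ΣL-cong (λ s → ΣL-map F (_∷ s) (upTo N)) (colourSeqs N m))

  -- the new first colour may be anything except the old first colour
  ΣL-compatible : ∀ j s → sumBelow (λ c → compatible c s * x c ℤ.^ j) N ≡ p (suc j) - headPower (suc j) s
  ΣL-compatible j []      = sym (ℤP.+-identityʳ _)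
  ΣL-compatible j (b ∷ s) = begin
    sumBelow (λ c → compatible c (b ∷ s) * x c ℤ.^ j) N
      ≡⟨ sumBelow-cong compatible-power N ⟩
    sumBelow (λ c → if c ≡ᵇ b then + 0 else x c ℤ.^ suc j) N
      ≡⟨ i+j≡k⇒i≡k-j (sumBelow-omit (λ c → x c ℤ.^ suc j) b N) ⟩
    p (suc j) - headPower (suc j) (b ∷ s)
      ∎
    where
      compatible-power : ∀ c → compatible c (b ∷ s) * x c ℤ.^ j ≡ (if c ≡ᵇ b then + 0 else x c ℤ.^ suc j)
      compatible-power c with c ≡ᵇ b
      ... | true  = refl
      ... | false = refl

  ΣL-extend : ∀ j m → ΣL (λ s → ΣL (λ c → weight (c ∷ s) * x c ℤ.^ j) (upTo N)) (colourSeqs N m)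
                      ≡ p (suc j) * S m - U (suc j) m
  ΣL-extend j m = begin
    ΣL (λ s → ΣL (λ c → weight (c ∷ s) * x c ℤ.^ j) (upTo N)) cs
      ≡⟨ ΣL-cong inner cs ⟩
    ΣL (λ s → p (suc j) * weight s + - (weight s * headPower (suc j) s)) cs
      ≡⟨ ΣL-+ _ _ cs ⟩
    ΣL (λ s → p (suc j) * weight s) cs + ΣL (λ s → - (weight s * headPower (suc j) s)) cs
      ≡⟨ cong₂ _+_ (ΣL-*ˡ (p (suc j)) weight cs) (ΣL-neg _ cs) ⟩
    p (suc j) * S m - U (suc j) m
      ∎
    where
      cs = colourSeqs N m
      inner : ∀ s → ΣL (λ c → weight (c ∷ s) * x c ℤ.^ j) (upTo N)
                    ≡ p (suc j) * weight s + - (weight s * headPower (suc j) s)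
      inner s = begin
        ΣL (λ c → weight (c ∷ s) * x c ℤ.^ j) (upTo N)
          ≡⟨ ΣL-cong (λ c → trans (cong (_* x c ℤ.^ j) (weight-∷ c s)) (ℤP.*-assoc (compatible c s) (weight s) (x c ℤ.^ j))) (upTo N) ⟩
        ΣL (λ c → compatible c s * (weight s * x c ℤ.^ j)) (upTo N)
          ≡⟨ ΣL-cong (λ c → ring (compatible c s) (weight s) (x c ℤ.^ j)) (upTo N) ⟩
        ΣL (λ c → weight s * (compatible c s * x c ℤ.^ j)) (upTo N)
          ≡⟨ trans (ΣL-*ˡ (weight s) _ (upTo N)) (cong (weight s *_) (ΣL-upTo _ N)) ⟩
        weight s * sumBelow (λ c → compatible c s * x c ℤ.^ j) N
          ≡⟨ cong (weight s *_) (ΣL-compatible j s) ⟩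
        weight s * (p (suc j) - headPower (suc j) s)
          ≡⟨ ring′ (weight s) (p (suc j)) (headPower (suc j) s) ⟩
        p (suc j) * weight s + - (weight s * headPower (suc j) s)
          ∎
        where ring : ∀ a b c → a * (b * c) ≡ b * (a * c)
              ring = solve-∀
              ring′ : ∀ a b c → a * (b - c) ≡ b * a + - (a * c)
              ring′ = solve-∀

  S-suc : ∀ m → S (suc m) ≡ p 1 * S m - U 1 m
  S-suc m = trans (ΣL-colourSeqs-suc weight m)
    (trans (ΣL-cong (λ s → ΣL-cong (λ c → sym (ℤP.*-identityʳ _)) (upTo N)) (colourSeqs N m)) (ΣL-extend 0 m))

  U-suc : ∀ j m → U j (suc m) ≡ p (suc j) * S m - U (suc j) m
  U-suc j m = trans (ΣL-colourSeqs-suc _ m) (trans (ΣL-cong first-colour-below-N (colourSeqs N m)) (ΣL-extend j m))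
    where
      guard : ∀ s c → (if c <ᵇ N then weight (c ∷ s) * x c ℤ.^ j else + 0) ≡ weight (c ∷ s) * headPower j (c ∷ s)
      guard s c with c <ᵇ N
      ... | true  = refl
      ... | false = sym (ℤP.*-zeroʳ (weight (c ∷ s)))
      first-colour-below-N : ∀ s → ΣL (λ c → weight (c ∷ s) * headPower j (c ∷ s)) (upTo N)
                                   ≡ ΣL (λ c → weight (c ∷ s) * x c ℤ.^ j) (upTo N)
      first-colour-below-N s = trans (ΣL-upTo _ N) (trans (sumBelow-cong (λ c → sym (guard s c)) N)
        (trans (sym (sumBelow-restrict _ N)) (sym (ΣL-upTo _ N))))

  Q : ℕ → Seq
  Q = signedPowerSums N x

  Q-0 : ∀ j → Q j 0 ≡ p (suc j)
  Q-0 j = trans (ℤP.*-identityˡ _) (cong (λ i → p (suc i)) (ℕP.+-identityʳ j))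

  Q-suc : ∀ j i → Q j (suc i) ≡ - Q (suc j) i
  Q-suc j i = trans (cong (λ k → - sgn i * p (suc k)) (ℕP.+-suc j i)) (sym (ℤP.neg-distribˡ-* (sgn i) _))

  ⋆-Q : ∀ j m → (Q j ⋆ S) (suc m) ≡ p (suc j) * S (suc m) - (Q (suc j) ⋆ S) m
  ⋆-Q j m = cong₂ _+_ (cong (_* S (suc m)) (Q-0 j)) (trans (⋆-cong (Q-suc j) (λ _ → refl) m) (⋆-negˡ (Q (suc j)) S m))

  U-⋆ : ∀ m j → U j (suc m) ≡ (Q j ⋆ S) m
  U-⋆ zero    j = trans (U-suc j 0) (trans (ℤP.+-identityʳ _) (cong (_* S 0) (sym (Q-0 j))))
  U-⋆ (suc m) j = trans (U-suc j (suc m)) (trans (cong (λ z → p (suc j) * S (suc m) - z) (U-⋆ m (suc j))) (sym (⋆-Q j m)))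

  XP-recurrence : ∀ m → S (suc m) ≡ (Q 0 ⋆ S) m
  XP-recurrence zero    = trans (S-suc 0) (trans (ℤP.+-identityʳ _) (cong (_* S 0) (sym (Q-0 0))))
  XP-recurrence (suc m) = trans (S-suc (suc m)) (trans (cong (λ z → p 1 * S (suc m) - z) (U-⋆ m 1)) (sym (⋆-Q 0 m)))

module Newton (x : Vars) where

  E : ℕ → Seq
  E N i = eN i N x

  P : ℕ → Seq
  P N zero    = + 0
  P N (suc i) = signedPowerSums N x 0 i

  -- With y = x_N and generating functions in t: E_{N+1} = (1 + y t) E_N, P_{N+1} = P_N + R
  -- where (1 + y t) R = y t; hence E_{N+1} P_{N+1} = (1 + y t) (t E_N′) + y t E_N = t E_{N+1}′.
  newton : ∀ N n → (E N ⋆ P N) n ≡ + n * E N n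
  newton zero    n       = trans (⋆-cong E₀≡δ (λ _ → refl) n) (trans (⋆-identityˡ (P 0) n) (P₀ n))
    where
      E₀≡δ : ∀ i → E 0 i ≡ δ i
      E₀≡δ zero    = refl
      E₀≡δ (suc i) = refl
      P₀ : ∀ n → P 0 n ≡ + n * E 0 n
      P₀ zero    = refl
      P₀ (suc n) = trans (ℤP.*-zeroʳ (sgn n)) (sym (ℤP.*-zeroʳ (+ suc n)))
  newton (suc N) n = goal n
    where
      y = x N
      L : Seq
      L zero    = + 1
      L (suc i) = scaledδ y i
      R : Seq
      R zero    = + 0
      R (suc i) = sgn i * y ℤ.^ suc i
      Z : Seq
      Z zero    = + 0
      Z (suc i) = scaledδ y i
      D : Seq
      D i = + i * E N i
      E-suc : ∀ i → E (suc N) i ≡ (L ⋆ E N) i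
      E-suc zero    = refl
      E-suc (suc i) = cong₂ _+_ (sym (ℤP.*-identityˡ (E N (suc i)))) (sym (⋆-scaledδˡ y (E N) i))
      P-suc : ∀ i → P (suc N) i ≡ P N i + R i
      P-suc zero    = refl
      P-suc (suc i) = trans (cong (sgn i *_) (sumBelow-suc (λ c → x c ℤ.^ suc i) N)) (ℤP.*-distribˡ-+ (sgn i) _ _)
      L⋆R : ∀ i → (L ⋆ R) i ≡ Z i
      L⋆R zero           = refl
      L⋆R (suc zero)     = ring y
        where ring : ∀ y → + 1 * (+ 1 * (y * + 1)) + y * + 0 ≡ y
              ring = solve-∀
      L⋆R (suc (suc k)) =
        trans (cong (_+_ (+ 1 * (- sgn k * (y * (y * y ℤ.^ k))))) (⋆-scaledδˡ y R (suc k))) (ring (sgn k) y (y ℤ.^ k))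
        where ring : ∀ s y w → + 1 * (- s * (y * (y * w))) + y * (s * (y * w)) ≡ + 0
              ring = solve-∀
      split : ∀ n → (E (suc N) ⋆ P (suc N)) n ≡ (L ⋆ D) n + (Z ⋆ E N) n
      split n = begin
        (E (suc N) ⋆ P (suc N)) n                   ≡⟨ ⋆-cong E-suc P-suc n ⟩
        ((L ⋆ E N) ⋆ (λ i → P N i + R i)) n         ≡⟨ ⋆-distribˡ-+ (L ⋆ E N) (P N) R n ⟩
        ((L ⋆ E N) ⋆ P N) n + ((L ⋆ E N) ⋆ R) n     ≡⟨ cong₂ _+_ (⋆-assoc L (E N) (P N) n) (⋆-cong (⋆-comm L (E N)) (λ _ → refl) n) ⟩
        (L ⋆ (E N ⋆ P N)) n + ((E N ⋆ L) ⋆ R) n     ≡⟨ cong₂ _+_ (⋆-cong (λ _ → refl) (newton N) n) (⋆-assoc (E N) L R n) ⟩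
        (L ⋆ D) n + (E N ⋆ (L ⋆ R)) n               ≡⟨ cong (_+_ ((L ⋆ D) n)) (trans (⋆-cong (λ _ → refl) L⋆R n) (⋆-comm (E N) Z n)) ⟩
        (L ⋆ D) n + (Z ⋆ E N) n                     ∎
      goal : ∀ n → (E (suc N) ⋆ P (suc N)) n ≡ + n * E (suc N) n
      goal zero    = split 0
      goal (suc m) = begin
        (E (suc N) ⋆ P (suc N)) (suc m)
          ≡⟨ split (suc m) ⟩
        (+ 1 * D (suc m) + (scaledδ y ⋆ D) m) + (+ 0 * E N (suc m) + (scaledδ y ⋆ E N) m)
          ≡⟨ cong₂ (λ u v → (+ 1 * D (suc m) + u) + (+ 0 * E N (suc m) + v)) (⋆-scaledδˡ y D m) (⋆-scaledδˡ y (E N) m) ⟩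
        (+ 1 * ((+ 1 + + m) * E N (suc m)) + y * (+ m * E N m)) + (+ 0 * E N (suc m) + y * E N m)
          ≡⟨ ring (+ m) (E N (suc m)) (E N m) y ⟩
        (+ 1 + + m) * (E N (suc m) + y * E N m)
          ∎
        where ring : ∀ m a b y → (+ 1 * ((+ 1 + m) * a) + y * (m * b)) + (+ 0 * a + y * b) ≡ (+ 1 + m) * (a + y * b)
              ring = solve-∀

-- The e-expansion of X_{P_m}

-- compositionsHead≥ j n lists the compositions of j + n whose first part is at least j.
mutual
  compositions : ℕ → List (List ℕ)
  compositions zero    = [] ∷ []
  compositions (suc m) = compositionsHead≥ 1 m

  compositionsHead≥ : ℕ → ℕ → List (List ℕ)
  compositionsHead≥ j zero    = map (j ∷_) (compositions 0)
  compositionsHead≥ j (suc n) = map (j ∷_) (compositions (suc n)) ++ compositionsHead≥ (suc j) n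

compositionsHead> : ℕ → ℕ → List (List ℕ)
compositionsHead> j zero    = []
compositionsHead> j (suc r) = compositionsHead≥ (suc j) r

-- the compositions of j + s + r with first part at least j and no partial sum equal to j + s
unsplit : ℕ → ℕ → ℕ → List (List ℕ)
unsplit j zero    r = compositionsHead> j r
unsplit j (suc s) r = map (j ∷_) (unsplit 1 s r) ++ unsplit (suc j) s r

IsComposition-∷ : ∀ {j m K} → 1 ℕ.≤ j → IsComposition m K → IsComposition (j ℕ.+ m) (j ∷ K)
IsComposition-∷ j≥1 (parts , total) = j≥1 ∷ parts , cong (_ ℕ.+_) total

IsComposition-resp : ∀ {m m′ K} → m ≡ m′ → IsComposition m K → IsComposition m′ K
IsComposition-resp refl c = c

mutual
  compositions-sound : ∀ m → All (IsComposition m) (compositions m)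
  compositions-sound zero    = ([] , refl) ∷ []
  compositions-sound (suc m) = compositionsHead≥-sound 1 m (s≤s z≤n)

  compositionsHead≥-sound : ∀ j n → 1 ℕ.≤ j → All (IsComposition (j ℕ.+ n)) (compositionsHead≥ j n)
  compositionsHead≥-sound j zero    j≥1 = IsComposition-∷ j≥1 ([] , refl) ∷ []
  compositionsHead≥-sound j (suc n) j≥1 =
    AllP.++⁺ (AllP.map⁺ (All.map (IsComposition-∷ j≥1) (compositions-sound (suc n))))
            (All.map (IsComposition-resp (sym (ℕP.+-suc j n))) (compositionsHead≥-sound (suc j) n (ℕP.m≤n⇒m≤1+n j≥1)))

unsplit-sound : ∀ s j r → 1 ℕ.≤ j → All (IsComposition (j ℕ.+ s ℕ.+ r)) (unsplit j s r)
unsplit-sound zero    j zero    j≥1 = []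
unsplit-sound zero    j (suc r) j≥1 =
  All.map (IsComposition-resp (trans (sym (ℕP.+-suc j r)) (cong (ℕ._+ suc r) (sym (ℕP.+-identityʳ j)))))
          (compositionsHead≥-sound (suc j) r (ℕP.m≤n⇒m≤1+n j≥1))
unsplit-sound (suc s) j r j≥1 =
  AllP.++⁺ (AllP.map⁺ (All.map (IsComposition-resp (sym (ℕP.+-assoc j (suc s) r)) ∘ IsComposition-∷ j≥1) (unsplit-sound s 1 r (s≤s z≤n))))
          (All.map (IsComposition-resp (cong (ℕ._+ r) (sym (ℕP.+-suc j s)))) (unsplit-sound s (suc j) r (ℕP.m≤n⇒m≤1+n j≥1)))

-- Λ_k ↦ e_k (in N variables) maps Ã_m and X̃_{P_m} to A m and X m.
module ECompositions (N : ℕ) (x : Vars) where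

  E : Seq
  E i = eN i N x

  termA termX : List ℕ → ℤ
  termA K = weightA K * eλ K N x
  termX K = weightX K * eλ K N x

  A X : Seq
  A m = ΣL termA (compositions m)
  X m = ΣL termX (compositions m)

  a b : Seq
  a i = pred1 i * E i
  b i = + i * E i

  termA-∷ : ∀ i J → termA (i ∷ J) ≡ a i * termA J
  termA-∷ i J = ring (pred1 i) (weightA J) (E i) (eλ J N x)
    where ring : ∀ a b c d → a * b * (c * d) ≡ a * c * (b * d)
          ring = solve-∀

  termX-∷ : ∀ i J → termX (i ∷ J) ≡ b i * termA J
  termX-∷ i J = ring (+ i) (weightA J) (E i) (eλ J N x)
    where ring : ∀ a b c d → a * b * (c * d) ≡ a * c * (b * d)
          ring = solve-∀

  module FirstPart (F : List ℕ → ℤ) (g : Seq) (F-∷ : ∀ i J → F (i ∷ J) ≡ g i * termA J) where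

    from : ℕ → Seq
    from j i = g (j ℕ.+ i)

    ΣL-map-∷ : ∀ j l → ΣL F (map (j ∷_) l) ≡ g j * ΣL termA l
    ΣL-map-∷ j l = trans (ΣL-map F (j ∷_) l) (trans (ΣL-cong (F-∷ j) l) (ΣL-*ˡ (g j) termA l))

    from⋆-0 : ∀ j (B : Seq) → (from j ⋆ B) 0 ≡ g j * B 0
    from⋆-0 j B = cong (λ k → g k * B 0) (ℕP.+-identityʳ j)

    from⋆-suc : ∀ j (B : Seq) m → (from j ⋆ B) (suc m) ≡ g j * B (suc m) + (from (suc j) ⋆ B) m
    from⋆-suc j B m = cong₂ _+_ (cong (λ k → g k * B (suc m)) (ℕP.+-identityʳ j))
                                (⋆-cong (λ i → cong g (ℕP.+-suc j i)) (λ _ → refl) m)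

    ΣL-compositionsHead≥ : ∀ n j → ΣL F (compositionsHead≥ j n) ≡ (from j ⋆ A) n
    ΣL-compositionsHead≥ zero    j = trans (ΣL-map-∷ j (compositions 0)) (sym (from⋆-0 j A))
    ΣL-compositionsHead≥ (suc n) j =
      trans (ΣL-++ F (map (j ∷_) (compositions (suc n))) (compositionsHead≥ (suc j) n))
            (trans (cong₂ _+_ (ΣL-map-∷ j (compositions (suc n))) (ΣL-compositionsHead≥ n (suc j)))
                   (sym (from⋆-suc j A n)))

  A-suc : ∀ m → A (suc m) ≡ ((a ∘ suc) ⋆ A) m
  A-suc m = FirstPart.ΣL-compositionsHead≥ termA a termA-∷ m 1

  X-suc : ∀ m → X (suc m) ≡ ((b ∘ suc) ⋆ A) m
  X-suc m = FirstPart.ΣL-compositionsHead≥ termX b termX-∷ m 1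

  ΣL-unsplit : ∀ (F : List ℕ → ℤ) (g : Seq) (F-∷ : ∀ i J → F (i ∷ J) ≡ g i * termA J) s j r →
    let open FirstPart F g F-∷ in
    ΣL F (unsplit j s r) ≡ (from j ⋆ A) (s ℕ.+ r) - (from j ⋆ A) s * A r
  ΣL-unsplit F g F-∷ zero j zero =
    sym (trans (cong (λ z → z - z * + 1) (from⋆-0 j A)) (ring (g j)))
    where open FirstPart F g F-∷
          ring : ∀ a → a * + 1 - a * + 1 * + 1 ≡ + 0
          ring = solve-∀
  ΣL-unsplit F g F-∷ zero j (suc r) =
    trans (ΣL-compositionsHead≥ r (suc j))
          (sym (trans (cong₂ (λ u v → u - v * A (suc r)) (from⋆-suc j A r) (from⋆-0 j A))
                      (ring (g j) (A (suc r)) ((from (suc j) ⋆ A) r))))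
    where open FirstPart F g F-∷
          ring : ∀ a b c → (a * b + c) - a * + 1 * b ≡ c
          ring = solve-∀
  ΣL-unsplit F g F-∷ (suc s) j r = begin
    ΣL F (map (j ∷_) (unsplit 1 s r) ++ unsplit (suc j) s r)
      ≡⟨ ΣL-++ F (map (j ∷_) (unsplit 1 s r)) (unsplit (suc j) s r) ⟩
    ΣL F (map (j ∷_) (unsplit 1 s r)) + ΣL F (unsplit (suc j) s r)
      ≡⟨ cong₂ _+_ (trans (ΣL-map-∷ j (unsplit 1 s r)) (cong (g j *_) (ΣL-unsplit termA a termA-∷ s 1 r)))
                   (ΣL-unsplit F g F-∷ s (suc j) r) ⟩
    g j * (A′ (s ℕ.+ r) - A′ s * A r) + (B (s ℕ.+ r) - B s * A r)
      ≡⟨ ring (g j) (A′ (s ℕ.+ r)) (A′ s) (A r) (B (s ℕ.+ r)) (B s) ⟩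
    (g j * A′ (s ℕ.+ r) + B (s ℕ.+ r)) - (g j * A′ s + B s) * A r
      ≡⟨ sym (cong₂ (λ u v → (g j * u + B (s ℕ.+ r)) - (g j * v + B s) * A r) (A-suc (s ℕ.+ r)) (A-suc s)) ⟩
    (g j * A (suc s ℕ.+ r) + B (s ℕ.+ r)) - (g j * A (suc s) + B s) * A r
      ≡⟨ sym (cong₂ (λ u v → u - v * A r) (from⋆-suc j A (s ℕ.+ r)) (from⋆-suc j A s)) ⟩
    (from j ⋆ A) (suc s ℕ.+ r) - (from j ⋆ A) (suc s) * A r
      ∎
    where
      open FirstPart F g F-∷
      B = from (suc j) ⋆ A
      A′ = (a ∘ suc) ⋆ A
      ring : ∀ a b c d e f → a * (b - c * d) + (e - f * d) ≡ (a * b + e) - (a * c + f) * d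
      ring = solve-∀

module PathExpansion (N : ℕ) (x : Vars) where
  open ECompositions N x
  open PathColourings N x using (S; Q; XP-recurrence)
  open Newton x using (P; newton)

  a⁺ : Seq
  a⁺ zero    = + 0
  a⁺ (suc i) = a (suc i)

  A≡δ+a⁺⋆A : ∀ n → A n ≡ δ n + (a⁺ ⋆ A) n
  A≡δ+a⁺⋆A zero    = refl
  A≡δ+a⁺⋆A (suc m) = trans (A-suc m) (sym (trans (ℤP.+-identityˡ _) (ℤP.+-identityˡ _)))

  E≡δ+b-a⁺ : ∀ i → E i ≡ (δ i + b i) - a⁺ i
  E≡δ+b-a⁺ zero    = refl
  E≡δ+b-a⁺ (suc i) = sym (ring (+ i) (E (suc i)))
    where ring : ∀ i e → (+ 0 + (+ 1 + i) * e) - ((+ 1 + i) - + 1) * e ≡ e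
          ring = solve-∀

  E⋆A≡δ+b⋆A : ∀ n → (E ⋆ A) n ≡ δ n + (b ⋆ A) n
  E⋆A≡δ+b⋆A n = begin
    (E ⋆ A) n                                       ≡⟨ ⋆-cong E≡δ+b-a⁺ (λ _ → refl) n ⟩
    ((λ i → (δ i + b i) - a⁺ i) ⋆ A) n              ≡⟨ ⋆-distribʳ-- (λ i → δ i + b i) a⁺ A n ⟩
    ((λ i → δ i + b i) ⋆ A) n - (a⁺ ⋆ A) n          ≡⟨ cong (_- (a⁺ ⋆ A) n) (⋆-distribʳ-+ δ b A n) ⟩
    ((δ ⋆ A) n + (b ⋆ A) n) - (a⁺ ⋆ A) n            ≡⟨ cong (λ z → (z + (b ⋆ A) n) - (a⁺ ⋆ A) n) (trans (⋆-identityˡ A n) (A≡δ+a⁺⋆A n)) ⟩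
    (δ n + (a⁺ ⋆ A) n + (b ⋆ A) n) - (a⁺ ⋆ A) n     ≡⟨ ring (δ n) ((a⁺ ⋆ A) n) ((b ⋆ A) n) ⟩
    δ n + (b ⋆ A) n                                 ∎
    where ring : ∀ a b c → (a + b + c) - b ≡ a + c
          ring = solve-∀

  -- Newton's identity b = E ⋆ P turns the expansion into the recurrence of XP.
  E⋆A-recurrence : ∀ m → (E ⋆ A) (suc m) ≡ (Q 0 ⋆ (E ⋆ A)) m
  E⋆A-recurrence m = begin
    (E ⋆ A) (suc m)            ≡⟨ trans (E⋆A≡δ+b⋆A (suc m)) (ℤP.+-identityˡ _) ⟩
    (b ⋆ A) (suc m)            ≡⟨ ⋆-cong (λ i → sym (newton N i)) (λ _ → refl) (suc m) ⟩
    ((E ⋆ P N) ⋆ A) (suc m)    ≡⟨ ⋆-cong (⋆-comm E (P N)) (λ _ → refl) (suc m) ⟩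
    ((P N ⋆ E) ⋆ A) (suc m)    ≡⟨ ⋆-assoc (P N) E A (suc m) ⟩
    (P N ⋆ (E ⋆ A)) (suc m)    ≡⟨ ℤP.+-identityˡ _ ⟩
    (Q 0 ⋆ (E ⋆ A)) m          ∎

  XP≡X : ∀ m → XP (suc m) N x ≡ X (suc m)
  XP≡X m = begin
    XP (suc m) N x     ≡⟨ ⋆-recurrence-unique (Q 0) S (E ⋆ A) refl XP-recurrence E⋆A-recurrence (suc m) ⟩
    (E ⋆ A) (suc m)    ≡⟨ trans (E⋆A≡δ+b⋆A (suc m)) (trans (ℤP.+-identityˡ _) (ℤP.+-identityˡ _)) ⟩
    ((b ∘ suc) ⋆ A) m  ≡⟨ sym (X-suc m) ⟩
    X (suc m)          ∎

  XP-unsplit : ∀ t k → XP (suc t ℕ.+ k) N x - XP (suc t) N x * A k ≡ ΣL termX (unsplit 1 t k)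
  XP-unsplit t k = begin
    XP (suc t ℕ.+ k) N x - XP (suc t) N x * A k
      ≡⟨ cong₂ (λ u v → u - v * A k) (trans (XP≡X (t ℕ.+ k)) (X-suc (t ℕ.+ k))) (trans (XP≡X t) (X-suc t)) ⟩
    ((b ∘ suc) ⋆ A) (t ℕ.+ k) - ((b ∘ suc) ⋆ A) t * A k
      ≡⟨ sym (ΣL-unsplit termX b termX-∷ t 1 k) ⟩
    ΣL termX (unsplit 1 t k)
      ∎

-- Linear independence of the e_λ

poly : (ℕ → ℤ) → ℕ → ℤ → ℤ
poly C zero    t = C 0
poly C (suc d) t = C 0 + t * poly (C ∘ suc) d t

poly-cong : ∀ {C C′} → (∀ j → C j ≡ C′ j) → ∀ d t → poly C d t ≡ poly C′ d t
poly-cong e zero    t = e 0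
poly-cong e (suc d) t = cong₂ _+_ (e 0) (cong (t *_) (poly-cong (e ∘ suc) d t))

poly-+ : ∀ C C′ d t → poly (λ j → C j + C′ j) d t ≡ poly C d t + poly C′ d t
poly-+ C C′ zero    t = refl
poly-+ C C′ (suc d) t =
  trans (cong (λ z → C 0 + C′ 0 + t * z) (poly-+ (C ∘ suc) (C′ ∘ suc) d t))
        (ring (C 0) (C′ 0) t (poly (C ∘ suc) d t) (poly (C′ ∘ suc) d t))
  where ring : ∀ a b t u v → a + b + t * (u + v) ≡ a + t * u + (b + t * v)
        ring = solve-∀

poly-*ˡ : ∀ (a : ℤ) C d t → poly (λ j → a * C j) d t ≡ a * poly C d t
poly-*ˡ a C zero    t = refl
poly-*ˡ a C (suc d) t =
  trans (cong (λ z → a * C 0 + t * z) (poly-*ˡ a (C ∘ suc) d t)) (ring a (C 0) t (poly (C ∘ suc) d t))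
  where ring : ∀ a b t u → a * b + t * (a * u) ≡ a * (b + t * u)
        ring = solve-∀

poly-0 : ∀ C d t → (∀ j → C j ≡ + 0) → poly C d t ≡ + 0
poly-0 C zero    t e = e 0
poly-0 C (suc d) t e = trans (cong₂ (λ u v → u + t * v) (e 0) (poly-0 (C ∘ suc) d t (e ∘ suc)))
                             (trans (ℤP.+-identityˡ _) (ℤP.*-zeroʳ t))

poly-δ : ∀ d t → poly δ d t ≡ + 1
poly-δ zero    t = refl
poly-δ (suc d) t = trans (cong (λ z → + 1 + t * z) (poly-0 _ d t (λ _ → refl))) (cong (_+_ (+ 1)) (ℤP.*-zeroʳ t))

poly-suc : ∀ C d t → C (suc d) ≡ + 0 → poly C (suc d) t ≡ poly C d t
poly-suc C zero    t e = trans (cong (λ z → C 0 + t * z) e) (trans (cong (_+_ (C 0)) (ℤP.*-zeroʳ t)) (ℤP.+-identityʳ _))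
poly-suc C (suc d) t e = cong (λ z → C 0 + t * z) (poly-suc (C ∘ suc) d t e)

shiftUp : Seq → Seq
shiftUp C zero    = + 0
shiftUp C (suc j) = C j

poly-shiftUp : ∀ C d t → poly (shiftUp C) (suc d) t ≡ t * poly C d t
poly-shiftUp C d t = ℤP.+-identityˡ _

poly-ΣL : ∀ {A : Set} (C : A → ℕ → ℤ) l d t → poly (λ j → ΣL (λ e → C e j) l) d t ≡ ΣL (λ e → poly (C e) d t) l
poly-ΣL C []      d t = poly-0 _ d t (λ _ → refl)
poly-ΣL C (e ∷ l) d t = trans (poly-+ (C e) _ d t) (cong (_+_ (poly (C e) d t)) (poly-ΣL C l d t))

-- Evaluating at t = |C 0| + 1 shows |C 0| ≥ (|C 0| + 1) |v| for an integer v, so C 0 = 0; then divide by t.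
poly-vanishing⇒coeffs≡0 : ∀ d C → (∀ t → poly C d (+ suc t) ≡ + 0) → ∀ j → j ℕ.≤ d → C j ≡ + 0
poly-vanishing⇒coeffs≡0 zero    C vanish zero    _ = vanish 0
poly-vanishing⇒coeffs≡0 (suc d) C vanish j j≤ = coeff j j≤
  where
    v : ℕ → ℤ
    v t = poly (C ∘ suc) d (+ suc t)
    c = ∣ C 0 ∣
    C₀≡- : ∀ t → C 0 ≡ - (+ suc t * v t)
    C₀≡- t = trans (i+j≡k⇒i≡k-j (vanish t)) (ℤP.+-identityˡ _)
    c≡ : c ≡ suc c ℕ.* ∣ v c ∣
    c≡ = trans (cong ∣_∣ (C₀≡- c)) (trans (ℤP.∣-i∣≡∣i∣ (+ suc c * v c)) (ℤP.abs-* (+ suc c) (v c)))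
    C₀≡0 : C 0 ≡ + 0
    C₀≡0 with ∣ v c ∣ in ∣vc∣
    ... | zero  = ℤP.∣i∣≡0⇒i≡0 (trans c≡ (trans (cong (suc c ℕ.*_) ∣vc∣) (ℕP.*-zeroʳ (suc c))))
    ... | suc w = contradiction (ℕP.≤-trans (ℕP.m≤m*n (suc c) (suc w)) (ℕP.≤-reflexive (sym (trans c≡ (cong (suc c ℕ.*_) ∣vc∣)))))
                                (ℕP.<-irrefl refl)
    v≡0 : ∀ t → v t ≡ + 0
    v≡0 t with ℤP.i*j≡0⇒i≡0∨j≡0 (+ suc t) (trans (sym (ℤP.+-identityˡ _)) (trans (cong (_+ (+ suc t * v t)) (sym C₀≡0)) (vanish t)))
    ... | inj₂ e = e
    coeff : ∀ j → j ℕ.≤ suc d → C j ≡ + 0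
    coeff zero    _         = C₀≡0
    coeff (suc j) (s≤s j≤d) = poly-vanishing⇒coeffs≡0 d (C ∘ suc) v≡0 j j≤d

nonzeroParts : List ℕ → ℕ
nonzeroParts []          = 0
nonzeroParts (zero ∷ l)  = nonzeroParts l
nonzeroParts (suc _ ∷ l) = suc (nonzeroParts l)

≡ᵇ-refl : ∀ n → (n ≡ᵇ n) ≡ true
≡ᵇ-refl zero    = refl
≡ᵇ-refl (suc n) = ≡ᵇ-refl n

≢⇒≡ᵇ≡false : ∀ {m n} → m ≢ n → (m ≡ᵇ n) ≡ false
≢⇒≡ᵇ≡false {m} {n} m≢n with m ≡ᵇ n in eq
... | false = refl
... | true  = contradiction (ℕP.≡ᵇ⇒≡ m n (subst T (sym eq) _)) m≢n

_[_≔_] : Vars → ℕ → ℤ → Vars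
(x [ N ≔ t ]) i = if i ≡ᵇ N then t else x i

eN-≔-below : ∀ x N t r N′ → N′ ℕ.≤ N → eN r N′ (x [ N ≔ t ]) ≡ eN r N′ x
eN-≔-below x N t zero    N′       _  = refl
eN-≔-below x N t (suc r) zero     _  = refl
eN-≔-below x N t (suc r) (suc N′) N′<N =
  cong₂ _+_ (eN-≔-below x N t (suc r) N′ (ℕP.<⇒≤ N′<N))
            (cong₂ _*_ (cong (λ b → if b then t else x N′) (≢⇒≡ᵇ≡false (ℕP.<⇒≢ N′<N))) (eN-≔-below x N t r N′ (ℕP.<⇒≤ N′<N)))

eN-≔ : ∀ x N t r → eN (suc r) (suc N) (x [ N ≔ t ]) ≡ eN (suc r) N x + t * eN r N x
eN-≔ x N t r = cong₂ _+_ (eN-≔-below x N t (suc r) N ℕP.≤-refl)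
  (cong₂ _*_ (cong (λ b → if b then t else x N) (≡ᵇ-refl N)) (eN-≔-below x N t r N ℕP.≤-refl))

-- tCoeff j l is the coefficient of tʲ in e_l(x₀, …, x_{N-1}, t).
module LastVariable (N : ℕ) (x : Vars) where

  tCoeff : ℕ → List ℕ → ℤ
  tCoeff j       []          = δ j
  tCoeff j       (zero ∷ l)  = tCoeff j l
  tCoeff zero    (suc r ∷ l) = eN (suc r) N x * tCoeff zero l
  tCoeff (suc j) (suc r ∷ l) = eN (suc r) N x * tCoeff (suc j) l + eN r N x * tCoeff j l

  tCoeff-high : ∀ l j → nonzeroParts l ℕ.< j → tCoeff j l ≡ + 0
  tCoeff-high []          (suc j) _ = refl
  tCoeff-high (zero ∷ l)  j       lt = tCoeff-high l j lt
  tCoeff-high (suc r ∷ l) (suc j) (s≤s lt) =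
    trans (cong₂ (λ u v → eN (suc r) N x * u + eN r N x * v) (tCoeff-high l (suc j) (ℕP.m≤n⇒m≤1+n lt)) (tCoeff-high l j lt))
          (ring (eN (suc r) N x) (eN r N x))
    where ring : ∀ a b → a * + 0 + b * + 0 ≡ + 0
          ring = solve-∀

  tCoeff-top : ∀ l → tCoeff (nonzeroParts l) l ≡ eλ (map pred l) N x
  tCoeff-top []          = refl
  tCoeff-top (zero ∷ l)  = trans (tCoeff-top l) (sym (ℤP.*-identityˡ _))
  tCoeff-top (suc r ∷ l) =
    trans (cong₂ (λ u v → eN (suc r) N x * u + eN r N x * v) (tCoeff-high l (suc (nonzeroParts l)) ℕP.≤-refl) (tCoeff-top l))
          (trans (cong (_+ eN r N x * eλ (map pred l) N x) (ℤP.*-zeroʳ (eN (suc r) N x))) (ℤP.+-identityˡ _))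

  poly-tCoeff : ∀ t l d → nonzeroParts l ℕ.≤ d → poly (λ j → tCoeff j l) d t ≡ eλ l (suc N) (x [ N ≔ t ])
  poly-tCoeff t []          d       _        = poly-δ d t
  poly-tCoeff t (zero ∷ l)  d       le       = trans (poly-tCoeff t l d le) (sym (ℤP.*-identityˡ _))
  poly-tCoeff t (suc r ∷ l) (suc d) (s≤s le) = begin
    poly (λ j → tCoeff j (suc r ∷ l)) (suc d) t
      ≡⟨ poly-cong split (suc d) t ⟩
    poly (λ j → e * C j + e′ * shiftUp C j) (suc d) t
      ≡⟨ poly-+ (λ j → e * C j) (λ j → e′ * shiftUp C j) (suc d) t ⟩
    poly (λ j → e * C j) (suc d) t + poly (λ j → e′ * shiftUp C j) (suc d) t
      ≡⟨ cong₂ _+_ (poly-*ˡ e C (suc d) t) (poly-*ˡ e′ (shiftUp C) (suc d) t) ⟩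
    e * poly C (suc d) t + e′ * poly (shiftUp C) (suc d) t
      ≡⟨ cong₂ (λ u v → e * u + e′ * v) (poly-suc C d t (tCoeff-high l (suc d) (s≤s le))) (poly-shiftUp C d t) ⟩
    e * poly C d t + e′ * (t * poly C d t)
      ≡⟨ cong (λ z → e * z + e′ * (t * z)) (poly-tCoeff t l d le) ⟩
    e * eλ l (suc N) x′ + e′ * (t * eλ l (suc N) x′)
      ≡⟨ ring e e′ t (eλ l (suc N) x′) ⟩
    (e + t * e′) * eλ l (suc N) x′
      ≡⟨ cong (_* eλ l (suc N) x′) (sym (eN-≔ x N t r)) ⟩
    eN (suc r) (suc N) x′ * eλ l (suc N) x′
      ∎
    where
      e = eN (suc r) N x
      e′ = eN r N x
      x′ = x [ N ≔ t ]
      C : Seq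
      C j = tCoeff j l
      split : ∀ j → tCoeff j (suc r ∷ l) ≡ e * C j + e′ * shiftUp C j
      split zero    = sym (trans (cong (_+_ (e * C 0)) (ℤP.*-zeroʳ e′)) (ℤP.+-identityʳ _))
      split (suc j) = refl
      ring : ∀ a b t E → a * E + b * (t * E) ≡ (a + t * b) * E
      ring = solve-∀

Decreasing : List ℕ → Set
Decreasing = Linked (λ a b → b ℕ.≤ a)

nonzeroParts≤sum : ∀ l → nonzeroParts l ℕ.≤ sum l
nonzeroParts≤sum []          = z≤n
nonzeroParts≤sum (zero ∷ l)  = nonzeroParts≤sum l
nonzeroParts≤sum (suc r ∷ l) = s≤s (ℕP.≤-trans (nonzeroParts≤sum l) (ℕP.m≤n+m (sum l) r))

nonzeroParts≤length : ∀ l → nonzeroParts l ℕ.≤ length l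
nonzeroParts≤length []          = z≤n
nonzeroParts≤length (zero ∷ l)  = ℕP.m≤n⇒m≤1+n (nonzeroParts≤length l)
nonzeroParts≤length (suc r ∷ l) = s≤s (nonzeroParts≤length l)

sum-map-pred : ∀ l → sum (map pred l) ℕ.+ nonzeroParts l ≡ sum l
sum-map-pred []          = refl
sum-map-pred (zero ∷ l)  = sum-map-pred l
sum-map-pred (suc r ∷ l) = trans (ℕP.+-suc (r ℕ.+ sum (map pred l)) (nonzeroParts l))
  (cong suc (trans (ℕP.+-assoc r _ _) (cong (r ℕ.+_) (sum-map-pred l))))

Decreasing-map-pred : ∀ {l} → Decreasing l → Decreasing (map pred l)
Decreasing-map-pred []          = []
Decreasing-map-pred [-]         = [-]
Decreasing-map-pred (r≤ ∷ decr) = ℕP.pred-mono-≤ r≤ ∷ Decreasing-map-pred decr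

nonzeroParts≡0⇒replicate : ∀ l → nonzeroParts l ≡ 0 → l ≡ replicate (length l) 0
nonzeroParts≡0⇒replicate []         _ = refl
nonzeroParts≡0⇒replicate (zero ∷ l) e = cong (0 ∷_) (nonzeroParts≡0⇒replicate l e)

Decreasing-0∷-zeros : ∀ l → Decreasing (0 ∷ l) → nonzeroParts l ≡ 0 × map pred l ≡ l
Decreasing-0∷-zeros []          _          = refl , refl
Decreasing-0∷-zeros (zero ∷ l)  (_ ∷ decr) = Product.map₂ (cong (0 ∷_)) (Decreasing-0∷-zeros l decr)
Decreasing-0∷-zeros (suc r ∷ l) (() ∷ _)

eλ-replicate-0 : ∀ n N x → eλ (replicate n 0) N x ≡ + 1
eλ-replicate-0 zero    N x = refl
eλ-replicate-0 (suc n) N x = trans (ℤP.*-identityˡ _) (eλ-replicate-0 n N x)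

incrementFirst : ℕ → List ℕ → List ℕ
incrementFirst zero    ν       = ν
incrementFirst (suc k) []      = []
incrementFirst (suc k) (v ∷ ν) = suc v ∷ incrementFirst k ν

-- The nonzero parts of a decreasing list come first.
incrementFirst-map-pred : ∀ l → Decreasing l → incrementFirst (nonzeroParts l) (map pred l) ≡ l
incrementFirst-map-pred []          _    = refl
incrementFirst-map-pred (zero ∷ l)  decr with Decreasing-0∷-zeros l decr
... | nz≡0 , pred≡ rewrite nz≡0 = cong (0 ∷_) pred≡
incrementFirst-map-pred (suc r ∷ l) decr = cong (suc r ∷_) (incrementFirst-map-pred l (Linked.tail decr))

-- A finite formal combination Σ c_λ · [λ]; it denotes Σ c_λ e_λ via ESum.
Entry : Set
Entry = List ℕ × ℤ

combine : (List ℕ → ℤ) → List Entry → ℤ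
combine Φ M = ΣL (λ e → proj₂ e * Φ (proj₁ e)) M

FormallyZero : List Entry → Set
FormallyZero M = ∀ Φ → combine Φ M ≡ + 0

VanishesAsE : List Entry → Set
VanishesAsE M = ∀ N x → ESum M N x ≡ + 0

Shape : ℕ → ℕ → ℕ → List ℕ → Set
Shape ℓ m p l = Decreasing l × length l ≡ ℓ × sum l ≡ m × nonzeroParts l ℕ.≤ p

combine-cong-All : ∀ {P : Entry → Set} {Φ Ψ : List ℕ → ℤ} {M} → All P M →
  (∀ {e} → P e → Φ (proj₁ e) ≡ Ψ (proj₁ e)) → combine Φ M ≡ combine Ψ M
combine-cong-All all eq = ΣL-cong-All all (λ {e} pe → cong (proj₂ e *_) (eq pe))

combine-*ˡ : ∀ (k : ℤ) Φ M → combine (λ l → k * Φ l) M ≡ k * combine Φ M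
combine-*ˡ k Φ M = trans (ΣL-cong (λ e → ring (proj₂ e) k (Φ (proj₁ e))) M) (ΣL-*ˡ k _ M)
  where ring : ∀ c k f → c * (k * f) ≡ k * (c * f)
        ring = solve-∀

decrement : Entry → Entry
decrement e = map pred (proj₁ e) , proj₂ e

nonzero≟ : ∀ k → Decidable (λ (e : Entry) → nonzeroParts (proj₁ e) ≡ k)
nonzero≟ k e = nonzeroParts (proj₁ e) ℕ.≟ k

Shape-0⇒replicate : ∀ {ℓ m l} → Shape ℓ m 0 l → l ≡ replicate ℓ 0
Shape-0⇒replicate {l = l} (_ , len , _ , nz≤0) =
  trans (nonzeroParts≡0⇒replicate l (ℕP.n≤0⇒n≡0 nz≤0)) (cong (λ n → replicate n 0) len)

Shape-decrement : ∀ {ℓ m p q l} → Shape ℓ m q l → nonzeroParts l ≡ suc p → Shape ℓ (m ∸ suc p) ℓ (map pred l)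
Shape-decrement {ℓ} {m} {p} {l = l} (decr , len , total , _) nz≡ =
  Decreasing-map-pred decr ,
  trans (LP.length-map pred l) len ,
  trans (sym (ℕP.m+n∸n≡m (sum (map pred l)) (suc p)))
        (cong (_∸ suc p) (trans (cong (sum (map pred l) ℕ.+_) (sym nz≡)) (trans (sum-map-pred l) total))) ,
  ℕP.≤-trans (nonzeroParts≤length (map pred l)) (ℕP.≤-reflexive (trans (LP.length-map pred l) len))

FormallyZero-constant : ∀ {ℓ m M} → All (Shape ℓ m 0 ∘ proj₁) M → VanishesAsE M → FormallyZero M
FormallyZero-constant {ℓ} {m} {M} shapes vanish Φ = begin
  combine Φ M                                         ≡⟨ combine-cong-All shapes (λ {e} → as-constant {e}) ⟩
  combine (λ l → Φ zeros * eλ l 0 (λ _ → + 0)) M      ≡⟨ combine-*ˡ (Φ zeros) _ M ⟩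
  Φ zeros * ESum M 0 (λ _ → + 0)                      ≡⟨ cong (Φ zeros *_) (vanish 0 _) ⟩
  Φ zeros * + 0                                       ≡⟨ ℤP.*-zeroʳ (Φ zeros) ⟩
  + 0                                                 ∎
  where
    zeros = replicate ℓ 0
    as-constant : ∀ {e} → Shape ℓ m 0 (proj₁ e) → Φ (proj₁ e) ≡ Φ zeros * eλ (proj₁ e) 0 (λ _ → + 0)
    as-constant sh rewrite Shape-0⇒replicate sh =
      sym (trans (cong (Φ zeros *_) (eλ-replicate-0 ℓ 0 _)) (ℤP.*-identityʳ _))

-- The coefficient of x_N^{p+1} in a vanishing combination of e_λ (at most p + 1 nonzero parts)
-- is the combination of the e_{λ - 1} with exactly p + 1 nonzero parts.
VanishesAsE-leading : ∀ p M → All (λ e → nonzeroParts (proj₁ e) ℕ.≤ suc p) M → VanishesAsE M →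
  VanishesAsE (map decrement (filter (nonzero≟ (suc p)) M))
VanishesAsE-leading p M bounded vanish N x = begin
  ESum (map decrement top) N x                        ≡⟨ ΣL-map _ decrement top ⟩
  combine (λ l → eλ (map pred l) N x) top             ≡⟨ combine-cong-All (AllP.all-filter (nonzero≟ (suc p)) M) (λ {e} → leading {e}) ⟩
  combine (tCoeff (suc p)) top                        ≡⟨ sym (trans (cong (_+_ (combine (tCoeff (suc p)) top)) rest≡0) (ℤP.+-identityʳ _)) ⟩
  combine (tCoeff (suc p)) top + combine (tCoeff (suc p)) rest
                                                      ≡⟨ sym (ΣL-partition (nonzero≟ (suc p)) _ M) ⟩
  combine (tCoeff (suc p)) M                          ≡⟨ poly-vanishing⇒coeffs≡0 (suc p) (λ j → combine (tCoeff j) M) vanishes (suc p) ℕP.≤-refl ⟩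
  + 0                                                 ∎
  where
    open LastVariable N x
    top = filter (nonzero≟ (suc p)) M
    rest = filter (¬? ∘ nonzero≟ (suc p)) M
    leading : ∀ {e} → nonzeroParts (proj₁ e) ≡ suc p → eλ (map pred (proj₁ e)) N x ≡ tCoeff (suc p) (proj₁ e)
    leading {e} nz≡ = trans (sym (tCoeff-top (proj₁ e))) (cong (λ j → tCoeff j (proj₁ e)) nz≡)
    rest≡0 : combine (tCoeff (suc p)) rest ≡ + 0
    rest≡0 = ΣL-vanish (All.zip (AllP.filter⁺ (¬? ∘ nonzero≟ (suc p)) bounded , AllP.all-filter (¬? ∘ nonzero≟ (suc p)) M))
      (λ {e} (nz≤ , nz≢) → trans (cong (proj₂ e *_) (tCoeff-high (proj₁ e) (suc p) (ℕP.≤∧≢⇒< nz≤ nz≢))) (ℤP.*-zeroʳ (proj₂ e)))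
    vanishes : ∀ t → poly (λ j → combine (tCoeff j) M) (suc p) (+ suc t) ≡ + 0
    vanishes t = begin
      poly (λ j → combine (tCoeff j) M) (suc p) (+ suc t)
        ≡⟨ poly-ΣL (λ e j → proj₂ e * tCoeff j (proj₁ e)) M (suc p) (+ suc t) ⟩
      ΣL (λ e → poly (λ j → proj₂ e * tCoeff j (proj₁ e)) (suc p) (+ suc t)) M
        ≡⟨ ΣL-cong-All bounded (λ {e} nz≤ → trans (poly-*ˡ (proj₂ e) (λ j → tCoeff j (proj₁ e)) (suc p) (+ suc t)) (cong (proj₂ e *_) (poly-tCoeff (+ suc t) (proj₁ e) (suc p) nz≤))) ⟩
      ESum M (suc N) (x [ N ≔ + suc t ])
        ≡⟨ vanish (suc N) _ ⟩
      + 0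
        ∎

FormallyZero-lift : ∀ k M → All (λ e → Decreasing (proj₁ e) × nonzeroParts (proj₁ e) ≡ k) M →
  FormallyZero (map decrement M) → FormallyZero M
FormallyZero-lift k M all zero-below Φ = begin
  combine Φ M                                          ≡⟨ combine-cong-All all (λ {e} → lift {e}) ⟩
  combine (Φ ∘ incrementFirst k ∘ map pred) M          ≡⟨ sym (ΣL-map _ decrement M) ⟩
  combine (Φ ∘ incrementFirst k) (map decrement M)     ≡⟨ zero-below (Φ ∘ incrementFirst k) ⟩
  + 0                                                  ∎
  where
    lift : ∀ {e} → Decreasing (proj₁ e) × nonzeroParts (proj₁ e) ≡ k → Φ (proj₁ e) ≡ Φ (incrementFirst k (map pred (proj₁ e)))
    lift {e} (decr , nz≡) =
      cong Φ (sym (trans (cong (λ j → incrementFirst j (map pred (proj₁ e))) (sym nz≡)) (incrementFirst-map-pred (proj₁ e) decr)))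

Independent : ℕ → Set
Independent m = ∀ ℓ p M → All (Shape ℓ m p ∘ proj₁) M → VanishesAsE M → FormallyZero M

FormallyZero-top : ∀ {ℓ m p M} → (∀ {m′} → m′ ℕ.< m → Independent m′) →
  All (Shape ℓ m (suc p) ∘ proj₁) M → VanishesAsE M → FormallyZero (filter (nonzero≟ (suc p)) M)
FormallyZero-top {ℓ} {m} {p} {M} ih shapes vanish with suc p ℕ.≤? m
... | no  p≰m = λ Φ → ΣL-vanish top-shapes (λ {e} sh → contradiction (nz≤m {e} sh) p≰m)
  where
    top-shapes = All.zip (AllP.filter⁺ (nonzero≟ (suc p)) shapes , AllP.all-filter (nonzero≟ (suc p)) M)
    nz≤m : ∀ {e} → Shape ℓ m (suc p) (proj₁ e) × nonzeroParts (proj₁ e) ≡ suc p → suc p ℕ.≤ m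
    nz≤m {e} ((_ , _ , total , _) , nz≡) = subst₂ ℕ._≤_ nz≡ total (nonzeroParts≤sum (proj₁ e))
... | yes p≤m = FormallyZero-lift (suc p) top (All.map (λ { ((decr , _) , nz≡) → decr , nz≡ }) top-shapes)
    (ih (ℕP.∸-monoʳ-< (s≤s z≤n) p≤m) ℓ ℓ (map decrement top)
        (AllP.map⁺ (All.map (λ (sh , nz≡) → Shape-decrement sh nz≡) top-shapes))
        (VanishesAsE-leading p M (All.map (λ (_ , _ , _ , nz≤) → nz≤) shapes) vanish))
  where
    top = filter (nonzero≟ (suc p)) M
    top-shapes = All.zip (AllP.filter⁺ (nonzero≟ (suc p)) shapes , AllP.all-filter (nonzero≟ (suc p)) M)

-- Split off the λ with the most nonzero parts: decremented, they form a vanishing combination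
-- of smaller degree; then recurse on the rest.
Independent-step : ∀ m → (∀ {m′} → m′ ℕ.< m → Independent m′) → Independent m
Independent-step m ih ℓ zero    M shapes vanish = FormallyZero-constant shapes vanish
Independent-step m ih ℓ (suc p) M shapes vanish Φ =
  trans (ΣL-partition (nonzero≟ (suc p)) _ M) (cong₂ _+_ (top-zero Φ) (rest-zero Φ))
  where
    rest = filter (¬? ∘ nonzero≟ (suc p)) M
    top-zero = FormallyZero-top ih shapes vanish
    rest-shapes : All (Shape ℓ m p ∘ proj₁) rest
    rest-shapes = All.map (λ ((decr , len , total , nz≤) , nz≢) → decr , len , total , ℕ.s≤s⁻¹ (ℕP.≤∧≢⇒< nz≤ nz≢))
      (All.zip (AllP.filter⁺ (¬? ∘ nonzero≟ (suc p)) shapes , AllP.all-filter (¬? ∘ nonzero≟ (suc p)) M))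
    rest-vanish : VanishesAsE rest
    rest-vanish N x = trans (sym (ℤP.+-identityˡ _))
      (trans (cong (_+ ESum rest N x) (sym (top-zero (λ l → eλ l N x))))
             (trans (sym (ΣL-partition (nonzero≟ (suc p)) _ M)) (vanish N x)))
    rest-zero : FormallyZero rest
    rest-zero = Independent-step m ih ℓ p rest rest-shapes rest-vanish

eλ-independent : ∀ m → Independent m
eλ-independent = <-rec Independent Independent-step

-- Uniqueness of e-expansions

Πℤ-↭ : Πℤ Preserves _↭_ ⟶ _≡_
Πℤ-↭ p = foldr-commMonoid ℤ-*-1.setoid ℤ-*-1.isCommutativeMonoid (↭⇒↭ₛ p)
  where module ℤ-*-1 = CommutativeMonoid ℤP.*-1-commutativeMonoid

eλ-↭ : ∀ {l l′} → l ↭ l′ → ∀ N x → eλ l N x ≡ eλ l′ N x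
eλ-↭ p N x = Πℤ-↭ (Perm.map⁺ (λ r → eN r N x) p)

IsPartition-sort : ∀ {m K} → IsComposition m K → IsPartition m (sort K)
IsPartition-sort {K = K} (parts , total) =
  sort-↗ K , Perm.All-resp-↭ (↭-sym (sort-↭ K)) parts , trans (sum-↭ (sort-↭ K)) total

has1⇒1∈ : ∀ {l} → has1 l ≡ true → 1 ∈ l
has1⇒1∈ {b ∷ l} h with b ≡ᵇ 1 in b≡ᵇ1
... | true  = here (sym (ℕP.≡ᵇ⇒≡ b 1 (subst T (sym b≡ᵇ1) _)))
... | false = there (has1⇒1∈ h)

1∈⇒has1 : ∀ {l} → 1 ∈ l → has1 l ≡ true
1∈⇒has1 (here refl) = refl
1∈⇒has1 {b ∷ l} (there 1∈l) = trans (cong ((b ≡ᵇ 1) ∨_) (1∈⇒has1 1∈l)) (∨-zeroʳ (b ≡ᵇ 1))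

remove1-↭ : ∀ {l} → 1 ∈ l → l ↭ 1 ∷ remove1 l
remove1-↭ {b ∷ l} 1∈ with b ≡ᵇ 1 in b≡ᵇ1
... | true rewrite ℕP.≡ᵇ⇒≡ b 1 (subst T (sym b≡ᵇ1) _) = ↭-refl
remove1-↭ {b ∷ l} (here refl)  | false = contradiction b≡ᵇ1 (λ ())
remove1-↭ {b ∷ l} (there 1∈l) | false = ↭-trans (↭-prep b (remove1-↭ 1∈l)) (↭-swap b 1 ↭-refl)

weightA-1∈ : ∀ {J} → 1 ∈ J → weightA J ≡ + 0
weightA-1∈ (here refl)         = refl
weightA-1∈ {i ∷ J} (there 1∈J) = trans (cong (pred1 i *_) (weightA-1∈ 1∈J)) (ℤP.*-zeroʳ (pred1 i))

weightA-nonneg : ∀ {K} → All (1 ℕ.≤_) K → ∃ λ w → weightA K ≡ + w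
weightA-nonneg []                     = 1 , refl
weightA-nonneg {suc i ∷ K} (_ ∷ parts) with weightA-nonneg parts
... | w , eq = i ℕ.* w , trans (cong (pred1 (suc i) *_) eq) (sym (ℤP.pos-* i w))

0≤c*weightA : ∀ c {K} → All (1 ℕ.≤_) K → + 0 ℤ.≤ + c * weightA K
0≤c*weightA c parts with weightA-nonneg parts
... | w , eq = subst (λ v → + 0 ℤ.≤ + c * v) (sym eq) (subst (+ 0 ℤ.≤_) (ℤP.pos-* c w) (ℤ.+≤+ z≤n))

weightX-nonneg : ∀ {K} → All (1 ℕ.≤_) K → + 0 ℤ.≤ weightX K
weightX-nonneg []                 = ℤ.+≤+ z≤n
weightX-nonneg {i ∷ K} (_ ∷ parts) = 0≤c*weightA i parts

compositions-suc : ∀ k → compositions (suc k) ≡ map (1 ∷_) (compositions k) ++ compositionsHead> 1 k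
compositions-suc zero    = sym (LP.++-identityʳ _)
compositions-suc (suc k) = refl

compositionsHead≥-head : ∀ j n → All (λ K → ∃₂ λ i J → K ≡ i ∷ J × j ℕ.≤ i) (compositionsHead≥ j n)
compositionsHead≥-head j zero    = (j , [] , refl , ℕP.≤-refl) ∷ []
compositionsHead≥-head j (suc n) =
  AllP.++⁺ (AllP.map⁺ (All.universal (λ J → j , J , refl , ℕP.≤-refl) _))
           (All.map (λ (i , J , eq , j<i) → i , J , eq , ℕP.<⇒≤ j<i) (compositionsHead≥-head (suc j) n))

sortedExpansion : List (List ℕ) → List Entry
sortedExpansion = map (λ K → sort K , weightX K)

ESum-sortedExpansion : ∀ Ks N x → ESum (sortedExpansion Ks) N x ≡ ΣL (ECompositions.termX N x) Ks
ESum-sortedExpansion Ks N x =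
  trans (ΣL-map _ _ Ks) (ΣL-cong (λ K → cong (weightX K *_) (eλ-↭ (sort-↭ K) N x)) Ks)

sortedExpansion-partitions : ∀ {m Ks} → All (IsComposition m) Ks → All (IsPartition m ∘ proj₁) (sortedExpansion Ks)
sortedExpansion-partitions = AllP.map⁺ ∘ All.map IsPartition-sort

sortedExpansion-nonneg : ∀ {m Ks} → All (IsComposition m) Ks → All (λ e → + 0 ℤ.≤ proj₂ e) (sortedExpansion Ks)
sortedExpansion-nonneg = AllP.map⁺ ∘ All.map (weightX-nonneg ∘ proj₁)

-- Independence is stated for lists of one fixed length, so partitions of m are padded with zeros to m parts.

pad : ℕ → List ℕ → List ℕ
pad m l = l ++ replicate (m ∸ length l) 0

strip : List ℕ → List ℕ
strip = filter (1 ℕ.≤?_)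

strip-pad : ∀ m {l} → All (1 ℕ.≤_) l → strip (pad m l) ≡ l
strip-pad m {l} parts = begin
  strip (l ++ replicate (m ∸ length l) 0)            ≡⟨ LP.filter-++ (1 ℕ.≤?_) l _ ⟩
  strip l ++ strip (replicate (m ∸ length l) 0)      ≡⟨ cong₂ _++_ (LP.filter-all (1 ℕ.≤?_) parts)
                                                               (LP.filter-none (1 ℕ.≤?_) (AllP.replicate⁺ {x = 0} (m ∸ length l) λ ())) ⟩
  l ++ []                                            ≡⟨ LP.++-identityʳ l ⟩
  l                                                  ∎

eλ-pad : ∀ n l N x → eλ (l ++ replicate n 0) N x ≡ eλ l N x
eλ-pad n []      N x = eλ-replicate-0 n N x
eλ-pad n (r ∷ l) N x = cong (eN r N x *_) (eλ-pad n l N x)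

sum-replicate-0 : ∀ n → sum (replicate n 0) ≡ 0
sum-replicate-0 zero    = refl
sum-replicate-0 (suc n) = sum-replicate-0 n

length≤sum : ∀ {l} → All (1 ℕ.≤_) l → length l ℕ.≤ sum l
length≤sum []           = z≤n
length≤sum (r≥1 ∷ parts) = ℕP.+-mono-≤ r≥1 (length≤sum parts)

Decreasing-++-0s : ∀ n l → Decreasing l → Decreasing (l ++ replicate n 0)
Decreasing-++-0s n       []          _           = zeros n
  where zeros : ∀ n → Decreasing (replicate n 0)
        zeros zero          = []
        zeros (suc zero)    = [-]
        zeros (suc (suc n)) = z≤n ∷ zeros (suc n)
Decreasing-++-0s zero    (r ∷ [])    _           = [-]
Decreasing-++-0s (suc n) (r ∷ [])    _           = z≤n ∷ Decreasing-++-0s n (0 ∷ []) [-]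
Decreasing-++-0s n       (r ∷ s ∷ l) (r≥s ∷ decr) = r≥s ∷ Decreasing-++-0s n (s ∷ l) decr

Shape-pad : ∀ {m l} → IsPartition m l → Shape m m m (pad m l)
Shape-pad {m} {l} (decr , parts , total) =
  Decreasing-++-0s _ l decr , length≡m ,
  trans (trans (sum-++ l _) (cong (sum l ℕ.+_) (sum-replicate-0 (m ∸ length l)))) (trans (ℕP.+-identityʳ _) total) ,
  ℕP.≤-trans (nonzeroParts≤length (pad m l)) (ℕP.≤-reflexive length≡m)
  where
    length≡m : length (pad m l) ≡ m
    length≡m = trans (LP.length-++ l) (trans (cong (length l ℕ.+_) (LP.length-replicate (m ∸ length l)))
                 (ℕP.m+[n∸m]≡n (ℕP.≤-trans (length≤sum parts) (ℕP.≤-reflexive total))))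

padEntry : ℕ → Entry → Entry
padEntry m e = pad m (proj₁ e) , proj₂ e

negEntry : Entry → Entry
negEntry e = proj₁ e , - proj₂ e

combine-difference : ∀ Φ m L L′ →
  combine Φ (map (padEntry m) L ++ map (padEntry m ∘ negEntry) L′) ≡ combine (Φ ∘ pad m) L - combine (Φ ∘ pad m) L′
combine-difference Φ m L L′ = begin
  combine Φ (map (padEntry m) L ++ map (padEntry m ∘ negEntry) L′)
    ≡⟨ ΣL-++ _ (map (padEntry m) L) _ ⟩
  combine Φ (map (padEntry m) L) + combine Φ (map (padEntry m ∘ negEntry) L′)
    ≡⟨ cong₂ _+_ (ΣL-map _ (padEntry m) L) (ΣL-map _ (padEntry m ∘ negEntry) L′) ⟩
  combine (Φ ∘ pad m) L + ΣL (λ e → - proj₂ e * Φ (pad m (proj₁ e))) L′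
    ≡⟨ cong (_+_ (combine (Φ ∘ pad m) L)) (trans (ΣL-cong (λ e → sym (ℤP.neg-distribˡ-* (proj₂ e) _)) L′) (ΣL-neg _ L′)) ⟩
  combine (Φ ∘ pad m) L - combine (Φ ∘ pad m) L′
    ∎

EExpansion-unique : ∀ {m F L L′} → IsEExpansion m F L → IsEExpansion m F L′ → ∀ Φ → combine Φ L ≡ combine Φ L′
EExpansion-unique {m} {F} {L} {L′} (partitions , expands) (partitions′ , expands′) Φ =
  ℤP.i-j≡0⇒i≡j _ _ (begin
    combine Φ L - combine Φ L′
      ≡⟨ cong₂ _-_ (combine-cong-All partitions (λ p → cong Φ (sym (strip-pad m (proj₁ (proj₂ p))))))
                   (combine-cong-All partitions′ (λ p → cong Φ (sym (strip-pad m (proj₁ (proj₂ p)))))) ⟩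
    combine (Φ ∘ strip ∘ pad m) L - combine (Φ ∘ strip ∘ pad m) L′
      ≡⟨ sym (combine-difference (Φ ∘ strip) m L L′) ⟩
    combine (Φ ∘ strip) M
      ≡⟨ eλ-independent m m m M shapes vanishes (Φ ∘ strip) ⟩
    + 0 ∎)
  where
    M = map (padEntry m) L ++ map (padEntry m ∘ negEntry) L′
    shapes : All (Shape m m m ∘ proj₁) M
    shapes = AllP.++⁺ (AllP.map⁺ (All.map Shape-pad partitions)) (AllP.map⁺ (All.map Shape-pad partitions′))
    vanishes : VanishesAsE M
    vanishes N x = begin
      ESum M N x
        ≡⟨ combine-difference (λ l → eλ l N x) m L L′ ⟩
      combine (λ l → eλ (pad m l) N x) L - combine (λ l → eλ (pad m l) N x) L′
        ≡⟨ cong₂ _-_ (ΣL-cong (λ e → cong (proj₂ e *_) (eλ-pad _ (proj₁ e) N x)) L)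
                     (ΣL-cong (λ e → cong (proj₂ e *_) (eλ-pad _ (proj₁ e) N x)) L′) ⟩
      ESum L N x - ESum L′ N x
        ≡⟨ cong₂ _-_ (sym (expands N x)) (sym (expands′ N x)) ⟩
      F N x - F N x
        ≡⟨ ℤP.+-inverseʳ (F N x) ⟩
      + 0 ∎

XP-expansion : ∀ k → IsEExpansion (suc k) (XP (suc k)) (sortedExpansion (compositions (suc k)))
XP-expansion k = sortedExpansion-partitions (compositions-sound (suc k)) ,
  λ N x → trans (PathExpansion.XP≡X N x k) (sym (ESum-sortedExpansion (compositions (suc k)) N x))

1∈sort-1∷ : ∀ J → 1 ∈ sort (1 ∷ J)
1∈sort-1∷ J = Perm.∈-resp-↭ (↭-sym (sort-↭ (1 ∷ J))) (here refl)

module RemoveOne (N : ℕ) (x : Vars) where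
  open ECompositions N x

  removeOne : List ℕ → ℤ
  removeOne l = if has1 l then eλ (remove1 l) N x else + 0

  AFrom≡combine : ∀ L → AFrom L N x ≡ combine removeOne L
  AFrom≡combine = ΣL-cong λ e → lemma (proj₂ e) (proj₁ e)
    where lemma : ∀ c l → (if has1 l then c * eλ (remove1 l) N x else + 0) ≡ c * removeOne l
          lemma c l with has1 l
          ... | true  = refl
          ... | false = sym (ℤP.*-zeroʳ c)

  removeOne-sort-1∷ : ∀ J → removeOne (sort (1 ∷ J)) ≡ eλ J N x
  removeOne-sort-1∷ J with has1 (sort (1 ∷ J)) in h
  ... | true  = eλ-↭ (Perm.drop-∷ (↭-trans (↭-sym (remove1-↭ (1∈sort-1∷ J))) (sort-↭ (1 ∷ J)))) N x
  ... | false = contradiction (trans (sym h) (1∈⇒has1 (1∈sort-1∷ J))) (λ ())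

  removeOne-sort-head≥2 : ∀ i J → 2 ℕ.≤ i → weightX (i ∷ J) * removeOne (sort (i ∷ J)) ≡ + 0
  removeOne-sort-head≥2 i J i≥2 with has1 (sort (i ∷ J)) in h
  ... | false = ℤP.*-zeroʳ (weightX (i ∷ J))
  ... | true with Perm.∈-resp-↭ (sort-↭ (i ∷ J)) (has1⇒1∈ h)
  ...   | here refl   = contradiction i≥2 λ { (s≤s ()) }
  ...   | there 1∈J = begin
    + i * weightA J * e   ≡⟨ cong (λ w → + i * w * e) (weightA-1∈ 1∈J) ⟩
    + i * + 0 * e         ≡⟨ cong (_* e) (ℤP.*-zeroʳ (+ i)) ⟩
    + 0                   ∎
    where e = eλ (remove1 (sort (i ∷ J))) N x

  removeOne-XP-expansion : ∀ k → combine removeOne (sortedExpansion (compositions (suc k))) ≡ A k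
  removeOne-XP-expansion k = begin
    combine removeOne (sortedExpansion (compositions (suc k)))
      ≡⟨ ΣL-map _ _ (compositions (suc k)) ⟩
    ΣL f (compositions (suc k))
      ≡⟨ cong (ΣL f) (compositions-suc k) ⟩
    ΣL f (map (1 ∷_) (compositions k) ++ compositionsHead> 1 k)
      ≡⟨ ΣL-++ f (map (1 ∷_) (compositions k)) _ ⟩
    ΣL f (map (1 ∷_) (compositions k)) + ΣL f (compositionsHead> 1 k)
      ≡⟨ cong₂ _+_ (trans (ΣL-map f (1 ∷_) (compositions k)) (ΣL-cong one-first (compositions k))) (head≥2 k) ⟩
    A k + + 0
      ≡⟨ ℤP.+-identityʳ (A k) ⟩
    A k ∎
    where
      f : List ℕ → ℤ
      f K = weightX K * removeOne (sort K)
      one-first : ∀ J → f (1 ∷ J) ≡ termA J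
      one-first J = cong₂ _*_ (ℤP.*-identityˡ (weightA J)) (removeOne-sort-1∷ J)
      head≥2 : ∀ k → ΣL f (compositionsHead> 1 k) ≡ + 0
      head≥2 zero    = refl
      head≥2 (suc n) = ΣL-vanish (compositionsHead≥-head 2 n) λ { (i , J , refl , i≥2) → removeOne-sort-head≥2 i J i≥2 }

  AFrom≡A : ∀ k L → IsEExpansion (suc k) (XP (suc k)) L → AFrom L N x ≡ A k
  AFrom≡A k L expansion = begin
    AFrom L N x                                                  ≡⟨ AFrom≡combine L ⟩
    combine removeOne L                                          ≡⟨ EExpansion-unique expansion (XP-expansion k) removeOne ⟩
    combine removeOne (sortedExpansion (compositions (suc k)))   ≡⟨ removeOne-XP-expansion k ⟩
    A k                                                          ∎

-- Λ-positivity of D̃_{n,k}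

·-∷ : ∀ F G b K → (F · G) (b ∷ K) ≡ F [] * G (b ∷ K) + ((λ J → F (b ∷ J)) · G) K
·-∷ F G b K = cong (_+_ (F [] * G (b ∷ K))) (begin
  ΣL f (applyUpTo suc (suc (length K)))    ≡⟨ cong (ΣL f) (sym (LP.map-upTo suc (suc (length K)))) ⟩
  ΣL f (map suc (upTo (suc (length K))))   ≡⟨ ΣL-map f suc (upTo (suc (length K))) ⟩
  ((λ J → F (b ∷ J)) · G) K                ∎)
  where f = λ j → F (take j (b ∷ K)) * G (drop j (b ∷ K))

·-congˡ : ∀ {F F′} G K → (∀ J → F J ≡ F′ J) → (F · G) K ≡ (F′ · G) K
·-congˡ G K eq = ΣL-cong (λ j → cong (_* G (drop j K)) (eq (take j K))) (upTo (suc (length K)))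

·-zeroˡ : ∀ F G K → (∀ J → F J ≡ + 0) → (F · G) K ≡ + 0
·-zeroˡ F G K eq = trans (·-congˡ G K eq) (ΣL-0 (upTo (suc (length K))))

+-≡ᵇ-+ : ∀ b m n → (b ℕ.+ m ≡ᵇ b ℕ.+ n) ≡ (m ≡ᵇ n)
+-≡ᵇ-+ zero    m n = refl
+-≡ᵇ-+ (suc b) m n = +-≡ᵇ-+ b m n

isComp-∷ : ∀ b r J → isComp (suc b ℕ.+ r) (suc b ∷ J) ≡ isComp r J
isComp-∷ b r J = cong (all (1 ≤ᵇ_) J ∧_) (+-≡ᵇ-+ (suc b) (sum J) r)

isComp-∷-> : ∀ b s J → s ℕ.< suc b → isComp s (suc b ∷ J) ≡ false
isComp-∷-> b s J s<b with all (1 ≤ᵇ_) J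
... | false = refl
... | true  = ≢⇒≡ᵇ≡false λ total → ℕP.<-irrefl refl (ℕP.<-≤-trans s<b (ℕP.≤-trans (ℕP.m≤m+n (suc b) (sum J)) (ℕP.≤-reflexive total)))

isComp-complete : ∀ {m I} → IsComposition m I → isComp m I ≡ true
isComp-complete {m} {I} (parts , total) = cong₂ _∧_ (all-parts parts) (trans (cong (sum I ≡ᵇ_) (sym total)) (≡ᵇ-refl (sum I)))
  where all-parts : ∀ {I} → All (1 ℕ.≤_) I → all (1 ≤ᵇ_) I ≡ true
        all-parts []                 = refl
        all-parts {suc i ∷ I} (_ ∷ ps) = all-parts ps

scaledA : ℕ → ℕ → NSym
scaledA c s J = if isComp s J then + c * weightA J else + 0

scaledA-∷ : ∀ c b r J → scaledA c (suc b ℕ.+ r) (suc b ∷ J) ≡ scaledA (c ℕ.* b) r J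
scaledA-∷ c b r J rewrite isComp-∷ b r J with isComp r J
... | true  = trans (sym (ℤP.*-assoc (+ c) (+ b) (weightA J))) (cong (_* weightA J) (sym (ℤP.pos-* c b)))
... | false = refl

Xt-∷ : ∀ t a J → suc a ℕ.≤ t → Xt t (suc a ∷ J) ≡ scaledA (suc a) (t ∸ suc a) J
Xt-∷ t a J a<t = begin
  Xt t (suc a ∷ J)                             ≡⟨ cong (λ t → Xt t (suc a ∷ J)) (sym (ℕP.m+[n∸m]≡n a<t)) ⟩
  Xt (suc a ℕ.+ (t ∸ suc a)) (suc a ∷ J)       ≡⟨ cong (λ b → if b then + suc a * weightA J else + 0) (isComp-∷ a (t ∸ suc a) J) ⟩
  scaledA (suc a) (t ∸ suc a) J                ∎

Xt-[] : ∀ {t} → 1 ℕ.≤ t → Xt t [] ≡ + 0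
Xt-[] (s≤s _) = refl

scaledA-[] : ∀ c {s} → 1 ℕ.≤ s → scaledA c s [] ≡ + 0
scaledA-[] c (s≤s _) = refl

scaledA[]*At-≤ : ∀ k c s {K} → All (1 ℕ.≤_) K → scaledA c s [] * At k K ℤ.≤ + c * weightA K
scaledA[]*At-≤ k c s {K} parts with isComp s [] | isComp k K
... | true  | true  = ℤP.≤-reflexive (cong (_* weightA K) (ℤP.*-identityʳ (+ c)))
... | true  | false = subst (ℤ._≤ + c * weightA K) (sym (ℤP.*-zeroʳ (+ c * + 1))) (0≤c*weightA c parts)
... | false | _     = 0≤c*weightA c parts

-- Of the splittings K = J ++ J′ only the one with J ⊨ s can contribute, and it contributes c · weightA K.
scaledA·At-≤ : ∀ k K → All (1 ℕ.≤_) K → ∀ c s → (scaledA c s · At k) K ℤ.≤ + c * weightA K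
scaledA·At-≤ k [] [] c s = subst (ℤ._≤ + c * + 1) (sym (ℤP.+-identityʳ _)) (scaledA[]*At-≤ k c s [])
scaledA·At-≤ k (suc b ∷ K) (_ ∷ parts) c s with suc b ℕ.≤? s
... | yes b<s = subst₂ ℤ._≤_ (sym split) merge (scaledA·At-≤ k K parts (c ℕ.* b) (s ∸ suc b))
  where
    split : (scaledA c s · At k) (suc b ∷ K) ≡ (scaledA (c ℕ.* b) (s ∸ suc b) · At k) K
    split = begin
      (scaledA c s · At k) (suc b ∷ K)
        ≡⟨ ·-∷ (scaledA c s) (At k) (suc b) K ⟩
      scaledA c s [] * At k (suc b ∷ K) + ((λ J → scaledA c s (suc b ∷ J)) · At k) K
        ≡⟨ cong₂ _+_ (cong (_* At k (suc b ∷ K)) (scaledA-[] c (ℕP.≤-trans (s≤s z≤n) b<s))) (·-congˡ (At k) K first-part) ⟩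
      + 0 * At k (suc b ∷ K) + (scaledA (c ℕ.* b) (s ∸ suc b) · At k) K
        ≡⟨ ℤP.+-identityˡ _ ⟩
      (scaledA (c ℕ.* b) (s ∸ suc b) · At k) K
        ∎
      where first-part : ∀ J → scaledA c s (suc b ∷ J) ≡ scaledA (c ℕ.* b) (s ∸ suc b) J
            first-part J = trans (cong (λ s → scaledA c s (suc b ∷ J)) (sym (ℕP.m+[n∸m]≡n b<s))) (scaledA-∷ c b (s ∸ suc b) J)
    merge : + (c ℕ.* b) * weightA K ≡ + c * weightA (suc b ∷ K)
    merge = trans (cong (_* weightA K) (ℤP.pos-* c b)) (ℤP.*-assoc (+ c) (+ b) (weightA K))
... | no  b≮s = subst (ℤ._≤ + c * weightA (suc b ∷ K)) (sym only-first) (scaledA[]*At-≤ k c s (s≤s z≤n ∷ parts))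
  where
    only-first : (scaledA c s · At k) (suc b ∷ K) ≡ scaledA c s [] * At k (suc b ∷ K)
    only-first = trans (·-∷ (scaledA c s) (At k) (suc b) K)
      (trans (cong (_+_ (scaledA c s [] * At k (suc b ∷ K)))
                   (·-zeroˡ _ (At k) K λ J → cong (λ b′ → if b′ then + c * weightA (suc b ∷ J) else + 0) (isComp-∷-> b s J (ℕP.≰⇒> b≮s))))
             (ℤP.+-identityʳ _))

Xt·At-≤ : ∀ k t I → 1 ℕ.≤ t → All (1 ℕ.≤_) I → (Xt t · At k) I ℤ.≤ weightX I
Xt·At-≤ k (suc t) []          _   []           = ℤ.+≤+ z≤n
Xt·At-≤ k t       (suc a ∷ K) t≥1 (_ ∷ parts) with suc a ℕ.≤? t
... | yes a<t = subst (ℤ._≤ weightX (suc a ∷ K)) (sym split) (scaledA·At-≤ k K parts (suc a) (t ∸ suc a))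
  where
    split : (Xt t · At k) (suc a ∷ K) ≡ (scaledA (suc a) (t ∸ suc a) · At k) K
    split = trans (·-∷ (Xt t) (At k) (suc a) K)
      (trans (cong₂ _+_ (cong (_* At k (suc a ∷ K)) (Xt-[] t≥1)) (·-congˡ (At k) K λ J → Xt-∷ t a J a<t))
             (ℤP.+-identityˡ _))
... | no  a≮t = subst (ℤ._≤ weightX (suc a ∷ K)) (sym vanishes) (weightX-nonneg {suc a ∷ K} (s≤s z≤n ∷ parts))
  where
    vanishes : (Xt t · At k) (suc a ∷ K) ≡ + 0
    vanishes = trans (·-∷ (Xt t) (At k) (suc a) K)
      (cong₂ _+_ (cong (_* At k (suc a ∷ K)) (Xt-[] t≥1))
                 (·-zeroˡ _ (At k) K λ J → cong (λ b → if b then weightX (suc a ∷ J) else + 0) (isComp-∷-> a t J (ℕP.≰⇒> a≮t))))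

Dt-nonneg : ∀ n k I → 1 ℕ.≤ n ∸ k → IsComposition n I → + 0 ℤ.≤ Dt n k I
Dt-nonneg n k I n>k comp@(parts , _) =
  subst (λ X → + 0 ℤ.≤ X - (Xt (n ∸ k) · At k) I) (sym (cong (λ b → if b then weightX I else + 0) (isComp-complete comp)))
        (ℤP.i≤j⇒0≤j-i (Xt·At-≤ k (n ∸ k) I n>k parts))

XP-difference-epositive : ∀ t k L → IsEExpansion (suc k) (XP (suc k)) L →
  EPositive (suc t ℕ.+ k) (λ N x → XP (suc t ℕ.+ k) N x - XP (suc t ℕ.+ k ∸ k) N x * AFrom L N x)
XP-difference-epositive t k L expansion =
  sortedExpansion (unsplit 1 t k) ,
  (sortedExpansion-partitions (unsplit-sound t 1 k (s≤s z≤n)) , expands) ,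
  sortedExpansion-nonneg (unsplit-sound t 1 k (s≤s z≤n))
  where
    expands : ∀ N x → XP (suc t ℕ.+ k) N x - XP (suc t ℕ.+ k ∸ k) N x * AFrom L N x
                      ≡ ESum (sortedExpansion (unsplit 1 t k)) N x
    expands N x = begin
      XP (suc t ℕ.+ k) N x - XP (suc t ℕ.+ k ∸ k) N x * AFrom L N x
        ≡⟨ cong₂ (λ m a → XP (suc t ℕ.+ k) N x - XP m N x * a) (ℕP.m+n∸n≡m (suc t) k) (RemoveOne.AFrom≡A N x k L expansion) ⟩
      XP (suc t ℕ.+ k) N x - XP (suc t) N x * ECompositions.A N x k
        ≡⟨ PathExpansion.XP-unsplit N x t k ⟩
      ΣL (ECompositions.termX N x) (unsplit 1 t k)
        ≡⟨ sym (ESum-sortedExpansion (unsplit 1 t k) N x) ⟩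
      ESum (sortedExpansion (unsplit 1 t k)) N x
        ∎

theorem3p6 : (n k : ℕ) → 1 ℕ.≤ k → k ℕ.≤ n ∸ 1 →
    ((I : List ℕ) → IsComposition n I → + 0 ℤ.≤ Dt n k I)
    × ((L : List (List ℕ × ℤ)) → IsEExpansion (suc k) (XP (suc k)) L →
       EPositive n (λ N x → XP n N x - XP (n ∸ k) N x * AFrom L N x))
theorem3p6 zero    (suc k) _ ()
theorem3p6 (suc n) k       _ k≤n =
  (λ I → Dt-nonneg (suc n) k I (ℕP.m<n⇒0<n∸m (s≤s k≤n))) ,
  (λ L expansion → subst (λ m → EPositive m (λ N x → XP m N x - XP (m ∸ k) N x * AFrom L N x))
                         (cong suc (ℕP.m∸n+n≡m k≤n))
                         (XP-difference-epositive (n ∸ k) k L expansion))
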